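{- Let $n=2k\ge 8$ (respectively $n=2k+1\ge 9$) and set $m=k-2$ (respectively $m=k-1$). Let $g_1,\dots,g_{2^{k-2}}$ be affine Boolean functions on $V_m$ such that (i) exactly a quarter of the $g_i$ are based on each of the blocks $A,B,C,D$, and (ii) $g_i\oplus g_j$ is balanced for all $1\le i\ne j\le 2^{k-2}$. Let $h_i=\mathbf{O}(g_i)$. For $1\le i\le 2^{k-2}$ put $P_i=g_ih_ig_i\bar h_i$, $Q_i=\bar h_ig_ih_ig_i$, $P_{i+2^{k-2}}=h_i\bar g_i\bar h_i\bar g_i$, $Q_{i+2^{k-2}}=\bar g_i\bar h_i\bar g_ih_i$ (concatenations of truth tables), and let $f$ be the Boolean function on $V_n$ whose truth table is $P_1P_2\cdots P_{2^{k-1}}\,Q_1Q_2\cdots Q_{2^{k-1}}$. Then $f$ is balanced, satisfies the SAC, has nonlinearity $N_f\ge 2^{n-1}-2^{\lfloor (n+1)/2\rfloor}$, and \[ 2^{2n+2}\le\sigma_f\le 2^{2n+2+\epsilon}, \] where $\epsilon=0$ if $n$ is even and $\epsilon=1$ if $n$ is odd.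
   Context: $V_m=\mathbb{Z}_2^m$; truth tables list values in lexicographic order of inputs and $\bar u$ denotes the bitwise complement. Let $A=0011$, $B=0101$, $C=0110$, $D=0000$. A binary string is based on $M\in\{A,B,C,D\}$ if it is a concatenation of 4-bit blocks each equal to $M$ or $\bar M$; every affine function on $V_m$ ($m\ge 2$) is based on one of these. For an affine $g$ with truth table $X_1\cdots X_{2^{m-2}}$ (4-bit blocks), $\mathbf{O}(g)=Y_1\cdots Y_{2^{m-2}}$ where $Y_1=X_1$ and, for $0\le i\le m-3$, $Y_{2^i+1}\cdots Y_{2^{i+1}}=\bar Y_1\cdots\bar Y_{2^i}$ if $X_{2^i+1}\cdots X_{2^{i+1}}=X_1\cdots X_{2^i}$, and $Y_{2^i+1}\cdots Y_{2^{i+1}}=Y_1\cdots Y_{2^i}$ if $X_{2^i+1}\cdots X_{2^{i+1}}=\bar X_1\cdots\bar X_{2^i}$. Balanced means weight equal to half the length. $\hat f=(-1)^f$, $\Delta_f(\alpha)=\sum_x\hat f(x)\hat f(x\oplus\alpha)$, $\sigma_f=\sum_{\alpha}\Delta_f(\alpha)^2$. $f$ satisfies the SAC if $\Delta_f(c)=0$ for all $c$ of Hamming weight $1$. $N_f$ is the minimum Hamming distance from $f$ to an affine function on $V_n$. -}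

module Defs where

open import Data.Bool using (Bool; true; false; not; _∧_; _xor_; if_then_else_; T)
open import Data.Bool.Properties using () renaming (_≟_ to _≟B_)
open import Data.Nat using (ℕ; zero; suc; _+_; _*_; _∸_; _^_; _⊓_)
open import Data.Fin using (Fin)
open import Data.List using (List; []; _∷_; _++_; map; take; drop; foldr; concat; allFin; length; filterᵇ)
open import Data.List.Properties using (≡-dec)
open import Data.Vec using (Vec; zipWith) renaming ([] to []ᵥ; _∷_ to _∷ᵥ_; foldr′ to vfoldr)
open import Data.Integer using (ℤ; +_; -_) renaming (_+_ to _+ℤ_; _*_ to _*ℤ_)
open import Data.Product using (Σ; _×_; _,_)
open import Relation.Nullary using (does)
open import Relation.Binary.PropositionalEquality using (_≡_)

-- Points of V_m = Z_2^m as bit vectors (first coordinate most significant),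
-- listed in lexicographic order.
points : (m : ℕ) → List (Vec Bool m)
points zero = []ᵥ ∷ []
points (suc m) = map (false ∷ᵥ_) (points m) ++ map (true ∷ᵥ_) (points m)

BoolFun : ℕ → Set
BoolFun m = Vec Bool m → Bool

tt : {m : ℕ} → BoolFun m → List Bool
tt {m} f = map f (points m)

compl : List Bool → List Bool
compl = map not

weight : List Bool → ℕ
weight l = length (filterᵇ (λ b → b) l)

vweight : {m : ℕ} → Vec Bool m → ℕ
vweight = vfoldr (λ b w → (if b then 1 else 0) + w) 0

Balanced : List Bool → Set
Balanced l = 2 * weight l ≡ length l

_⊕_ : {m : ℕ} → Vec Bool m → Vec Bool m → Vec Bool m
_⊕_ = zipWith _xor_

dot : {m : ℕ} → Vec Bool m → Vec Bool m → Bool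
dot a x = vfoldr _xor_ false (zipWith _∧_ a x)

affineFun : {m : ℕ} → Vec Bool m → Bool → BoolFun m
affineFun a c x = dot a x xor c

Affine : {m : ℕ} → BoolFun m → Set
Affine {m} g = Σ (Vec Bool m) λ a → Σ Bool λ c → ∀ x → g x ≡ affineFun a c x

data Block : Set where
  A B C D : Block

bits : Block → List Bool
bits A = false ∷ false ∷ true ∷ true ∷ []
bits B = false ∷ true ∷ false ∷ true ∷ []
bits C = false ∷ true ∷ true ∷ false ∷ []
bits D = false ∷ false ∷ false ∷ false ∷ []

_==_ : List Bool → List Bool → Bool
l == l' = does (≡-dec _≟B_ l l')

basedOn : Block → List Bool → Bool
basedOn M [] = true
basedOn M (b₁ ∷ b₂ ∷ b₃ ∷ b₄ ∷ rest) =
  ((b₁ ∷ b₂ ∷ b₃ ∷ b₄ ∷ []) == bits M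
    Data.Bool.∨ (b₁ ∷ b₂ ∷ b₃ ∷ b₄ ∷ []) == compl (bits M))
  ∧ basedOn M rest
basedOn M _ = false

BasedOn : Block → List Bool → Set
BasedOn M l = T (basedOn M l)

countFin : {N : ℕ} → (Fin N → Bool) → ℕ
countFin {N} p = length (filterᵇ p (allFin N))

Opre : ℕ → List Bool → List Bool
Opre zero X = take 4 X
Opre (suc i) X =
  Y ++ (if take L (drop L X) == take L X then compl Y else Y)
  where
  Y = Opre i X
  L = 4 * 2 ^ i

O : (m : ℕ) → List Bool → List Bool
O m X = Opre (m ∸ 2) X

-- the construction: n = 2k + ε, m = k - 2 + ε
module Construction (k ε : ℕ) (g : Fin (2 ^ (k ∸ 2)) → BoolFun (k ∸ 2 + ε)) where
  m : ℕ
  m = k ∸ 2 + ε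

  G : Fin (2 ^ (k ∸ 2)) → List Bool
  G i = tt (g i)

  h : Fin (2 ^ (k ∸ 2)) → List Bool
  h i = O m (G i)

  -- P_i and Q_i for 1 ≤ i ≤ 2^{k-2}
  P₁ Q₁ : Fin (2 ^ (k ∸ 2)) → List Bool
  P₁ i = G i ++ h i ++ G i ++ compl (h i)
  Q₁ i = compl (h i) ++ G i ++ h i ++ G i
  -- P_{i+2^{k-2}} and Q_{i+2^{k-2}}
  P₂ Q₂ : Fin (2 ^ (k ∸ 2)) → List Bool
  P₂ i = h i ++ compl (G i) ++ compl (h i) ++ compl (G i)
  Q₂ i = compl (G i) ++ compl (h i) ++ compl (G i) ++ h i

  all : (Fin (2 ^ (k ∸ 2)) → List Bool) → List Bool
  all F = concat (map F (allFin (2 ^ (k ∸ 2))))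

  table : List Bool
  table = all P₁ ++ all P₂ ++ all Q₁ ++ all Q₂

sgn : Bool → ℤ
sgn b = if b then - (+ 1) else + 1

sumℤ : List ℤ → ℤ
sumℤ = foldr _+ℤ_ (+ 0)

Δ : {n : ℕ} → BoolFun n → Vec Bool n → ℤ
Δ {n} f α = sumℤ (map (λ x → sgn (f x) *ℤ sgn (f (x ⊕ α))) (points n))

σ : {n : ℕ} → BoolFun n → ℤ
σ {n} f = sumℤ (map (λ α → Δ f α *ℤ Δ f α) (points n))

SAC : {n : ℕ} → BoolFun n → Set
SAC {n} f = ∀ (c : Vec Bool n) → vweight c ≡ 1 → Δ f c ≡ + 0

dist : {n : ℕ} → BoolFun n → BoolFun n → ℕ
dist f g = weight (map (λ x → f x xor g x) (points _))

affines : (n : ℕ) → List (Vec Bool n × Bool)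
affines n = map (λ a → (a , false)) (points n) ++ map (λ a → (a , true)) (points n)

-- nonlinearity: minimum distance to an affine function (min over a nonempty
-- list; the initial value 2^n is an upper bound for every distance)
N : {n : ℕ} → BoolFun n → ℕ
N {n} f = foldr (λ ac r → dist f (affineFun (Data.Product.proj₁ ac) (Data.Product.proj₂ ac)) ⊓ r)
                (2 ^ n) (affines n)

module Submission where

-- Write a point of V_n as (s, t, u, z₁, z₂, w) with u ∈ V_r the index of g_u(w) = a(u)·w ⊕ c(u) and
-- (s, t, z₁, z₂) selecting a quarter of a block P_i or Q_i.  O(g_u) is again affine, namely
-- g_u ⊕ e·w with e = (1, …, 1, 0, 0), so the construction is the Maiorana–McFarland-type function
--   f(s, t, u, z₁, z₂, w) = a(u)·w ⊕ c(u) ⊕ (s ⊕ t ⊕ z₂)(e·w) ⊕ q(s, t, z₁, z₂)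
-- built from a fixed four-variable gadget, and pairwise balancedness of the g_i makes a injective.
-- Consequently Δ_f(α) vanishes unless the u-part of α is 0, and then it factors as
-- 2^m · Δ_gadget · S(α_w) with S(β) = Σ_u (-1)^(a(u)·β); Parseval for S and a finite computation for
-- the gadget give σ_f = 2^(2n+2+ε) exactly.  For the SAC, a unit vector α_w orthogonal to e picks out
-- one of the last two coefficients of a(u), which are equidistributed by the block-count hypothesis,
-- so S(α_w) = 0.  In the Walsh transform of f at (b_v, b_u, b_w) only the at most two u with
-- a(u) = b_w or a(u) = b_w ⊕ e survive, contributing at most 2^(m+3) in total; since m + 2 = ⌊(n+1)/2⌋
-- this is the nonlinearity bound.

open import Defs
open import Data.Bool using (Bool; true; false; not; _∧_; _∨_; _xor_; if_then_else_)
import Data.Bool.Properties as BP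
open import Data.Nat using (ℕ; zero; suc; z≤n; s≤s; _<_; _+_; _*_; _∸_; _^_; _≤_; _/_; _⊓_)
import Data.Nat.Properties as ℕP
import Data.Nat.Tactic.RingSolver as NS
import Data.Nat.DivMod as DM
import Data.Nat.Divisibility as ND
open import Data.Integer using (ℤ; +_; -_) renaming (_+_ to _+ℤ_; _*_ to _*ℤ_; _≤_ to _≤ℤ_)
import Data.Integer as ℤ
import Data.Integer.Properties as ℤP
open import Data.Integer.Tactic.RingSolver using (solve-∀)
open import Data.Vec using (Vec; []; _∷_; _++_; splitAt; take; drop)
import Data.Vec.Properties as VP
open import Data.List using (List; map; concat; length; foldr) renaming (_++_ to _++ₗ_)
import Data.List as L
open import Data.List.Membership.Propositional using (_∈_)
open import Data.List.Membership.Propositional.Properties using (∈-map⁺; ∈-++⁺ˡ; ∈-++⁺ʳ)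
open import Data.List.Relation.Unary.Any using (here; there)
import Data.List.Properties as LP
open import Data.Fin using (Fin; toℕ; fromℕ<)
import Data.Fin.Properties as FP
open import Data.Empty using (⊥-elim)
open import Data.Product using (Σ; _×_; _,_; proj₁; proj₂)
open import Data.Sum using (_⊎_; inj₁; inj₂)
open import Relation.Nullary using (Dec; yes; no; ¬_)
open import Relation.Nullary.Decidable using (True; toWitness; dec-true; dec-false)
open import Relation.Binary.Definitions using (DecidableEquality)
open import Relation.Binary.PropositionalEquality using (_≡_; _≢_; refl; sym; trans; cong; cong₂; subst; subst₂; module ≡-Reasoning)

∑ : (n : ℕ) → (Vec Bool n → ℤ) → ℤ
∑ zero F = F []
∑ (suc n) F = ∑ n (λ x → F (false ∷ x)) +ℤ ∑ n (λ x → F (true ∷ x))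

sumℤ-++ : ∀ (xs ys : List ℤ) → sumℤ (xs ++ₗ ys) ≡ sumℤ xs +ℤ sumℤ ys
sumℤ-++ L.[] ys = sym (ℤP.+-identityˡ _)
sumℤ-++ (x L.∷ xs) ys = trans (cong (x +ℤ_) (sumℤ-++ xs ys)) (sym (ℤP.+-assoc x _ _))

sumℤ-points : ∀ n (F : Vec Bool n → ℤ) → sumℤ (map F (points n)) ≡ ∑ n F
sumℤ-points zero F = ℤP.+-identityʳ _
sumℤ-points (suc n) F = begin
    sumℤ (map F (map (false ∷_) P ++ₗ map (true ∷_) P))
  ≡⟨ cong sumℤ (LP.map-++ F (map (false ∷_) P) _) ⟩
    sumℤ (map F (map (false ∷_) P) ++ₗ map F (map (true ∷_) P))
  ≡⟨ sumℤ-++ (map F (map (false ∷_) P)) _ ⟩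
    sumℤ (map F (map (false ∷_) P)) +ℤ sumℤ (map F (map (true ∷_) P))
  ≡⟨ cong₂ _+ℤ_ (cong sumℤ (sym (LP.map-∘ P))) (cong sumℤ (sym (LP.map-∘ P))) ⟩
    sumℤ (map (λ x → F (false ∷ x)) P) +ℤ sumℤ (map (λ x → F (true ∷ x)) P)
  ≡⟨ cong₂ _+ℤ_ (sumℤ-points n _) (sumℤ-points n _) ⟩
    ∑ (suc n) F ∎
  where
  open ≡-Reasoning
  P = points n

∑-cong : ∀ n {F G : Vec Bool n → ℤ} → (∀ x → F x ≡ G x) → ∑ n F ≡ ∑ n G
∑-cong zero F≗G = F≗G []
∑-cong (suc n) F≗G = cong₂ _+ℤ_ (∑-cong n (λ x → F≗G (false ∷ x))) (∑-cong n (λ x → F≗G (true ∷ x)))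

∑-distrib-+ : ∀ n (F G : Vec Bool n → ℤ) → ∑ n (λ x → F x +ℤ G x) ≡ ∑ n F +ℤ ∑ n G
∑-distrib-+ zero F G = refl
∑-distrib-+ (suc n) F G = trans (cong₂ _+ℤ_ (∑-distrib-+ n _ _) (∑-distrib-+ n _ _))
  (interchange (∑ n (λ x → F (false ∷ x))) (∑ n (λ x → G (false ∷ x))) (∑ n (λ x → F (true ∷ x))) (∑ n (λ x → G (true ∷ x))))
  where
  interchange : ∀ a b c d → (a +ℤ b) +ℤ (c +ℤ d) ≡ (a +ℤ c) +ℤ (b +ℤ d)
  interchange = solve-∀

∑-*ˡ : ∀ n c (F : Vec Bool n → ℤ) → ∑ n (λ x → c *ℤ F x) ≡ c *ℤ ∑ n F
∑-*ˡ zero c F = refl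
∑-*ˡ (suc n) c F = trans (cong₂ _+ℤ_ (∑-*ˡ n c _) (∑-*ˡ n c _)) (sym (ℤP.*-distribˡ-+ c _ _))

∑-*ʳ : ∀ n c (F : Vec Bool n → ℤ) → ∑ n (λ x → F x *ℤ c) ≡ ∑ n F *ℤ c
∑-*ʳ n c F = trans (∑-cong n (λ x → ℤP.*-comm (F x) c)) (trans (∑-*ˡ n c F) (ℤP.*-comm c _))

∑-zero : ∀ n → ∑ n (λ _ → + 0) ≡ + 0
∑-zero zero = refl
∑-zero (suc n) = cong₂ _+ℤ_ (∑-zero n) (∑-zero n)

∑-const : ∀ n c → ∑ n (λ _ → c) ≡ + (2 ^ n) *ℤ c
∑-const zero c = sym (ℤP.*-identityˡ c)
∑-const (suc n) c = begin
    ∑ n (λ _ → c) +ℤ ∑ n (λ _ → c)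
  ≡⟨ cong₂ _+ℤ_ (∑-const n c) (∑-const n c) ⟩
    + (2 ^ n) *ℤ c +ℤ + (2 ^ n) *ℤ c
  ≡⟨ sym (ℤP.*-distribʳ-+ c (+ (2 ^ n)) (+ (2 ^ n))) ⟩
    (+ (2 ^ n) +ℤ + (2 ^ n)) *ℤ c
  ≡⟨ cong (λ k → + (2 ^ n + k) *ℤ c) (sym (ℕP.+-identityʳ (2 ^ n))) ⟩
    + (2 ^ suc n) *ℤ c ∎
  where open ≡-Reasoning

∑-++ : ∀ a {b} (F : Vec Bool (a + b) → ℤ) → ∑ (a + b) F ≡ ∑ a (λ x → ∑ b (λ y → F (x ++ y)))
∑-++ zero F = refl
∑-++ (suc a) F = cong₂ _+ℤ_ (∑-++ a _) (∑-++ a _)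

∑-comm : ∀ a b (F : Vec Bool a → Vec Bool b → ℤ) →
  ∑ a (λ x → ∑ b (λ y → F x y)) ≡ ∑ b (λ y → ∑ a (λ x → F x y))
∑-comm zero b F = refl
∑-comm (suc a) b F = trans (cong₂ _+ℤ_ (∑-comm a b _) (∑-comm a b _)) (sym (∑-distrib-+ b _ _))

allVec? : ∀ n {P : Vec Bool n → Set} → (∀ v → Dec (P v)) → Dec (∀ v → P v)
allVec? zero P? with P? []
... | yes p = yes λ { [] → p }
... | no ¬p = no λ f → ¬p (f [])
allVec? (suc n) P? with allVec? n (λ v → P? (false ∷ v)) | allVec? n (λ v → P? (true ∷ v))
... | yes p | yes q = yes λ { (false ∷ v) → p v ; (true ∷ v) → q v }
... | no ¬p | _ = no λ f → ¬p (λ v → f (false ∷ v))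
... | yes _ | no ¬q = no λ f → ¬q (λ v → f (true ∷ v))

≡-exhaustive : ∀ {A : Set} (_≟_ : DecidableEquality A) n (l r : Vec Bool n → A) →
  {True (allVec? n (λ v → l v ≟ r v))} → ∀ v → l v ≡ r v
≡-exhaustive _ n l r {p} = toWitness p

≤ℤ-exhaustive : ∀ n (l r : Vec Bool n → ℤ) → {True (allVec? n (λ v → ℤ._≤?_ (l v) (r v)))} → ∀ v → l v ≤ℤ r v
≤ℤ-exhaustive n l r {p} = toWitness p

sgn-xor : ∀ x y → sgn (x xor y) ≡ sgn x *ℤ sgn y
sgn-xor false false = refl
sgn-xor false true = refl
sgn-xor true false = refl
sgn-xor true true = refl

sgn-not : ∀ x → sgn x +ℤ sgn (not x) ≡ + 0
sgn-not false = refl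
sgn-not true = refl

sumℤ-sgn+2*weight : ∀ (l : List Bool) → sumℤ (map sgn l) +ℤ + (2 * weight l) ≡ + length l
sumℤ-sgn+2*weight L.[] = refl
sumℤ-sgn+2*weight (false L.∷ l) = trans (ℤP.+-assoc (+ 1) (sumℤ (map sgn l)) _) (cong (+ 1 +ℤ_) (sumℤ-sgn+2*weight l))
sumℤ-sgn+2*weight (true L.∷ l) = begin
    (- (+ 1) +ℤ s) +ℤ + (2 * suc w)
  ≡⟨ cong (λ k → (- (+ 1) +ℤ s) +ℤ + k) (ℕP.*-suc 2 w) ⟩
    (- (+ 1) +ℤ s) +ℤ + (2 + 2 * w)
  ≡⟨ shift s (+ (2 * w)) ⟩
    + 1 +ℤ (s +ℤ + (2 * w))
  ≡⟨ cong (+ 1 +ℤ_) (sumℤ-sgn+2*weight l) ⟩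
    + suc (length l) ∎
  where
  open ≡-Reasoning
  s = sumℤ (map sgn l)
  w = weight l
  shift : ∀ a b → (- (+ 1) +ℤ a) +ℤ (+ 2 +ℤ b) ≡ + 1 +ℤ (a +ℤ b)
  shift = solve-∀

zeros : ∀ n → Vec Bool n
zeros zero = []
zeros (suc n) = false ∷ zeros n

isZero : ∀ {n} → Vec Bool n → Bool
isZero [] = true
isZero (false ∷ v) = isZero v
isZero (true ∷ v) = false

isZero⇒≡zeros : ∀ {n} (x : Vec Bool n) → isZero x ≡ true → x ≡ zeros n
isZero⇒≡zeros [] _ = refl
isZero⇒≡zeros (false ∷ x) z = cong (false ∷_) (isZero⇒≡zeros x z)
isZero⇒≡zeros (true ∷ x) ()

isZero-zeros : ∀ n → isZero (zeros n) ≡ true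
isZero-zeros zero = refl
isZero-zeros (suc n) = isZero-zeros n

vweight≡0⇒isZero : ∀ {n} (x : Vec Bool n) → vweight x ≡ 0 → isZero x ≡ true
vweight≡0⇒isZero [] _ = refl
vweight≡0⇒isZero (false ∷ x) w = vweight≡0⇒isZero x w
vweight≡0⇒isZero (true ∷ x) ()

vweight-zeros : ∀ n → vweight (zeros n) ≡ 0
vweight-zeros zero = refl
vweight-zeros (suc n) = vweight-zeros n

⊕-identityˡ : ∀ {n} (x : Vec Bool n) → zeros n ⊕ x ≡ x
⊕-identityˡ [] = refl
⊕-identityˡ (b ∷ x) = cong (b ∷_) (⊕-identityˡ x)

⊕-identityʳ : ∀ {n} (x : Vec Bool n) → x ⊕ zeros n ≡ x
⊕-identityʳ [] = refl
⊕-identityʳ (b ∷ x) = cong₂ _∷_ (BP.xor-identityʳ b) (⊕-identityʳ x)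

⊕-self : ∀ {n} (x : Vec Bool n) → x ⊕ x ≡ zeros n
⊕-self [] = refl
⊕-self (b ∷ x) = cong₂ _∷_ (BP.xor-same b) (⊕-self x)

⊕-assoc : ∀ {n} (x y z : Vec Bool n) → (x ⊕ y) ⊕ z ≡ x ⊕ (y ⊕ z)
⊕-assoc [] [] [] = refl
⊕-assoc (a ∷ x) (b ∷ y) (c ∷ z) = cong₂ _∷_ (BP.xor-assoc a b c) (⊕-assoc x y z)

⊕-cancelʳ : ∀ {n} (x y e : Vec Bool n) → x ⊕ e ≡ y ⊕ e → x ≡ y
⊕-cancelʳ {n} x y e eq = begin
    x                ≡⟨ cancel x ⟩
    (x ⊕ e) ⊕ e      ≡⟨ cong (_⊕ e) eq ⟩
    (y ⊕ e) ⊕ e      ≡⟨ sym (cancel y) ⟩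
    y                ∎
  where
  open ≡-Reasoning
  cancel : ∀ z → z ≡ (z ⊕ e) ⊕ e
  cancel z = sym (trans (⊕-assoc z e e) (trans (cong (z ⊕_) (⊕-self e)) (⊕-identityʳ z)))

≡-from-isZero-⊕ : ∀ {n} (x y : Vec Bool n) → isZero (x ⊕ y) ≡ true → x ≡ y
≡-from-isZero-⊕ x y z = ⊕-cancelʳ x y y (trans (isZero⇒≡zeros (x ⊕ y) z) (sym (⊕-self y)))

isZero-⊕-self : ∀ {n} (x : Vec Bool n) → isZero (x ⊕ x) ≡ true
isZero-⊕-self {n} x = trans (cong isZero (⊕-self x)) (isZero-zeros n)

dot-⊕ˡ : ∀ {m} (a b w : Vec Bool m) → dot (a ⊕ b) w ≡ dot a w xor dot b w
dot-⊕ˡ [] [] [] = refl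
dot-⊕ˡ (x ∷ a) (y ∷ b) (z ∷ w) = trans (cong (((x xor y) ∧ z) xor_) (dot-⊕ˡ a b w))
  (≡-exhaustive BP._≟_ 5 (λ { (x ∷ y ∷ z ∷ p ∷ q ∷ []) → ((x xor y) ∧ z) xor (p xor q) })
                         (λ { (x ∷ y ∷ z ∷ p ∷ q ∷ []) → ((x ∧ z) xor p) xor ((y ∧ z) xor q) })
                         (x ∷ y ∷ z ∷ dot a w ∷ dot b w ∷ []))

dot-comm : ∀ {m} (a w : Vec Bool m) → dot a w ≡ dot w a
dot-comm [] [] = refl
dot-comm (x ∷ a) (y ∷ w) = cong₂ _xor_ (BP.∧-comm x y) (dot-comm a w)

dot-⊕ʳ : ∀ {m} (a w w' : Vec Bool m) → dot a (w ⊕ w') ≡ dot a w xor dot a w'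
dot-⊕ʳ a w w' = trans (dot-comm a (w ⊕ w')) (trans (dot-⊕ˡ w w' a) (cong₂ _xor_ (dot-comm w a) (dot-comm w' a)))

dot-xor-dot-⊕ : ∀ {m} (e w α : Vec Bool m) → dot e w xor dot e (w ⊕ α) ≡ dot e α
dot-xor-dot-⊕ e w α = begin
    dot e w xor dot e (w ⊕ α)          ≡⟨ cong (dot e w xor_) (dot-⊕ʳ e w α) ⟩
    dot e w xor (dot e w xor dot e α)  ≡⟨ BP.xor-assoc (dot e w) (dot e w) (dot e α) ⟨
    (dot e w xor dot e w) xor dot e α  ≡⟨ cong (_xor dot e α) (BP.xor-same (dot e w)) ⟩
    dot e α                            ∎
  where open ≡-Reasoning

dot-++ : ∀ {p q} (a : Vec Bool p) (b : Vec Bool q) x y → dot (a ++ b) (x ++ y) ≡ dot a x xor dot b y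
dot-++ [] b [] y = refl
dot-++ (c ∷ a) b (z ∷ x) y = trans (cong ((c ∧ z) xor_) (dot-++ a b x y)) (sym (BP.xor-assoc (c ∧ z) (dot a x) (dot b y)))

dot-zerosʳ : ∀ {m} (a : Vec Bool m) → dot a (zeros m) ≡ false
dot-zerosʳ [] = refl
dot-zerosʳ (x ∷ a) = trans (cong (_xor dot a (zeros _)) (BP.∧-zeroʳ x)) (dot-zerosʳ a)

δ₀ : ∀ {m} → Vec Bool m → ℤ
δ₀ {m} p = if isZero p then + (2 ^ m) else + 0

∑-sgn-dot : ∀ m (p : Vec Bool m) → ∑ m (λ w → sgn (dot p w)) ≡ δ₀ p
∑-sgn-dot zero [] = refl
∑-sgn-dot (suc m) (false ∷ p) = trans (cong₂ _+ℤ_ (∑-sgn-dot m p) (∑-sgn-dot m p)) (double (isZero p))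
  where
  double : ∀ b → (if b then + (2 ^ m) else + 0) +ℤ (if b then + (2 ^ m) else + 0) ≡ (if b then + (2 ^ suc m) else + 0)
  double false = refl
  double true = cong (λ k → + (2 ^ m + k)) (sym (ℕP.+-identityʳ (2 ^ m)))
∑-sgn-dot (suc m) (true ∷ p) = begin
    ∑ m (λ w → sgn (dot p w)) +ℤ ∑ m (λ w → sgn (not (dot p w)))
  ≡⟨ sym (∑-distrib-+ m _ _) ⟩
    ∑ m (λ w → sgn (dot p w) +ℤ sgn (not (dot p w)))
  ≡⟨ ∑-cong m (λ w → sgn-not (dot p w)) ⟩
    ∑ m (λ _ → + 0)
  ≡⟨ ∑-zero m ⟩
    + 0 ∎
  where open ≡-Reasoning

δ₀-* : ∀ {k} (p : Vec Bool k) Y → δ₀ p *ℤ Y ≡ (if isZero p then + (2 ^ k) *ℤ Y else + 0)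
δ₀-* p Y with isZero p
... | true = refl
... | false = ℤP.*-zeroˡ Y

∑-δ : ∀ n (u : Vec Bool n) c → ∑ n (λ u' → if isZero (u ⊕ u') then c else + 0) ≡ c
∑-δ zero [] c = refl
∑-δ (suc n) (false ∷ u) c = trans (cong (∑ n (λ u' → if isZero (u ⊕ u') then c else + 0) +ℤ_) (∑-zero n))
                                  (trans (ℤP.+-identityʳ _) (∑-δ n u c))
∑-δ (suc n) (true ∷ u) c = trans (cong (_+ℤ ∑ n (λ u' → if isZero (u ⊕ u') then c else + 0)) (∑-zero n))
                                 (trans (ℤP.+-identityˡ _) (∑-δ n u c))

AtMostOne : ∀ {n} → (Vec Bool n → Bool) → Set
AtMostOne P = ∀ x y → P x ≡ true → P y ≡ true → x ≡ y

∑-atMostOne : ∀ n (P : Vec Bool n → Bool) (F : Vec Bool n → ℤ) → AtMostOne P →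
  (∑ n (λ x → if P x then F x else + 0) ≡ + 0) ⊎ (Σ (Vec Bool n) λ x → P x ≡ true × ∑ n (λ x → if P x then F x else + 0) ≡ F x)
∑-atMostOne zero P F _ with P [] in eq
... | true = inj₂ ([] , eq , refl)
... | false = inj₁ refl
∑-atMostOne (suc n) P F uniq with ∑-atMostOne n (λ x → P (false ∷ x)) (λ x → F (false ∷ x)) (λ x y px py → VP.∷-injectiveʳ (uniq _ _ px py))
                               | ∑-atMostOne n (λ x → P (true ∷ x)) (λ x → F (true ∷ x)) (λ x y px py → VP.∷-injectiveʳ (uniq _ _ px py))
... | inj₁ e₀ | inj₁ e₁ = inj₁ (cong₂ _+ℤ_ e₀ e₁)
... | inj₁ e₀ | inj₂ (x , px , e₁) = inj₂ (true ∷ x , px , trans (cong₂ _+ℤ_ e₀ e₁) (ℤP.+-identityˡ _))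
... | inj₂ (x , px , e₀) | inj₁ e₁ = inj₂ (false ∷ x , px , trans (cong₂ _+ℤ_ e₀ e₁) (ℤP.+-identityʳ _))
... | inj₂ (x , px , _) | inj₂ (y , py , _) with uniq (false ∷ x) (true ∷ y) px py
... | ()

∑-atMostOne-≤ : ∀ n (P : Vec Bool n → Bool) (F : Vec Bool n → ℤ) {bound : ℤ} → AtMostOne P →
  + 0 ≤ℤ bound → (∀ x → F x ≤ℤ bound) → ∑ n (λ x → if P x then F x else + 0) ≤ℤ bound
∑-atMostOne-≤ n P F {bound} uniq 0≤bound F≤bound with ∑-atMostOne n P F uniq
... | inj₁ e = subst (_≤ℤ bound) (sym e) 0≤bound
... | inj₂ (x , _ , e) = subst (_≤ℤ bound) (sym e) (F≤bound x)

length-points : ∀ n → length (points n) ≡ 2 ^ n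
length-points zero = refl
length-points (suc n) = begin
    length (map (false ∷_) P ++ₗ map (true ∷_) P)
  ≡⟨ LP.length-++ (map (false ∷_) P) ⟩
    length (map (false ∷_) P) + length (map (true ∷_) P)
  ≡⟨ cong₂ _+_ (LP.length-map _ P) (LP.length-map _ P) ⟩
    length P + length P
  ≡⟨ cong₂ _+_ (length-points n) (trans (length-points n) (sym (ℕP.+-identityʳ _))) ⟩
    2 ^ suc n ∎
  where
  open ≡-Reasoning
  P = points n

length-tt : ∀ {n} (f : BoolFun n) → length (tt f) ≡ 2 ^ n
length-tt {n} f = trans (LP.length-map f (points n)) (length-points n)

∈-points : ∀ {n} (x : Vec Bool n) → x ∈ points n
∈-points [] = here refl
∈-points (false ∷ x) = ∈-++⁺ˡ (∈-map⁺ (false ∷_) (∈-points x))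
∈-points (true ∷ x) = ∈-++⁺ʳ _ (∈-map⁺ (true ∷_) (∈-points x))

map-≡⇒≡ : ∀ {X Y : Set} {f g : X → Y} {xs : List X} {x} → map f xs ≡ map g xs → x ∈ xs → f x ≡ g x
map-≡⇒≡ e (here refl) = LP.∷-injectiveˡ e
map-≡⇒≡ e (there x∈xs) = map-≡⇒≡ (LP.∷-injectiveʳ e) x∈xs

tt-injective : ∀ {n} (f g : BoolFun n) → tt f ≡ tt g → ∀ x → f x ≡ g x
tt-injective f g e x = map-≡⇒≡ e (∈-points x)

map-points-++ : ∀ {X : Set} a b (G : Vec Bool (a + b) → X) →
  map G (points (a + b)) ≡ concat (map (λ y → map (λ z → G (y ++ z)) (points b)) (points a))
map-points-++ zero b G = sym (LP.++-identityʳ _)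
map-points-++ (suc a) b G = begin
    map G (map (false ∷_) (points (a + b)) ++ₗ map (true ∷_) (points (a + b)))
  ≡⟨ LP.map-++ G (map (false ∷_) (points (a + b))) _ ⟩
    map G (map (false ∷_) (points (a + b))) ++ₗ map G (map (true ∷_) (points (a + b)))
  ≡⟨ cong₂ _++ₗ_ (sym (LP.map-∘ (points (a + b)))) (sym (LP.map-∘ (points (a + b)))) ⟩
    map (λ x → G (false ∷ x)) (points (a + b)) ++ₗ map (λ x → G (true ∷ x)) (points (a + b))
  ≡⟨ cong₂ _++ₗ_ (map-points-++ a b _) (map-points-++ a b _) ⟩
    concat (map (λ y → H (false ∷ y)) (points a)) ++ₗ concat (map (λ y → H (true ∷ y)) (points a))
  ≡⟨ cong₂ _++ₗ_ (cong concat (LP.map-∘ (points a))) (cong concat (LP.map-∘ (points a))) ⟩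
    concat (map H (map (false ∷_) (points a))) ++ₗ concat (map H (map (true ∷_) (points a)))
  ≡⟨ LP.concat-++ (map H (map (false ∷_) (points a))) _ ⟩
    concat (map H (map (false ∷_) (points a)) ++ₗ map H (map (true ∷_) (points a)))
  ≡⟨ cong concat (sym (LP.map-++ H (map (false ∷_) (points a)) _)) ⟩
    concat (map H (points (suc a))) ∎
  where
  open ≡-Reasoning
  H : Vec Bool (suc a) → List _
  H y = map (λ z → G (y ++ z)) (points b)

map-points-2+ : ∀ {X : Set} n (φ : Vec Bool (2 + n) → X) →
  map φ (points (2 + n)) ≡ map (λ x → φ (false ∷ false ∷ x)) (points n) ++ₗ (map (λ x → φ (false ∷ true ∷ x)) (points n)
     ++ₗ (map (λ x → φ (true ∷ false ∷ x)) (points n) ++ₗ map (λ x → φ (true ∷ true ∷ x)) (points n)))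
map-points-2+ n φ = trans (map-points-++ 2 n φ)
  (cong (λ l → map (λ x → φ (false ∷ false ∷ x)) (points n) ++ₗ (map (λ x → φ (false ∷ true ∷ x)) (points n)
     ++ₗ (map (λ x → φ (true ∷ false ∷ x)) (points n) ++ₗ l))) (LP.++-identityʳ _))

-- For v = (s, t, z₁, z₂), quarter (z₁, z₂) of the block selected by (s, t) (P_i, P_{i+2^(k-2)}, Q_i,
-- Q_{i+2^(k-2)} in that order) is a copy of h_i iff usesH v, and it is complemented iff q v.
q : Vec Bool 4 → Bool
q (false ∷ false ∷ z₁ ∷ z₂ ∷ []) = z₁ ∧ z₂
q (false ∷ true ∷ z₁ ∷ z₂ ∷ []) = z₁ ∨ z₂
q (true ∷ false ∷ z₁ ∷ z₂ ∷ []) = not (z₁ ∨ z₂)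
q (true ∷ true ∷ z₁ ∷ z₂ ∷ []) = not (z₁ ∧ z₂)

usesH : Vec Bool 4 → Bool
usesH (s ∷ t ∷ z₁ ∷ z₂ ∷ []) = z₂ xor (s xor t)

gadget : Bool → Bool → Vec Bool 4 → Bool
gadget a E v = a xor ((usesH v ∧ E) xor q v)

gadgetΔ : Vec Bool 4 → Bool → ℤ
gadgetΔ αv δ = ∑ 4 (λ v → sgn (gadget false false v xor gadget false δ (v ⊕ αv)))

unless : Bool → ℤ → ℤ
unless b z = if b then + 0 else z

onUsesH : Bool → Vec Bool 4 → ℤ → ℤ
onUsesH j v = unless (usesH v xor j)

gadgetW : Vec Bool 4 → Bool → ℤ
gadgetW bv j = ∑ 4 (λ v → onUsesH j v (sgn (q v xor dot bv v)))

∣gadgetW∣ : Vec Bool 4 → Bool → ℤ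
∣gadgetW∣ bv j = + ℤ.∣ gadgetW bv j ∣

usesH-⊕ : ∀ v αv → usesH (v ⊕ αv) ≡ usesH v xor usesH αv
usesH-⊕ (s ∷ t ∷ _ ∷ z₂ ∷ []) (s' ∷ t' ∷ _ ∷ z₂' ∷ []) = ≡-exhaustive BP._≟_ 6
  (λ { (s ∷ t ∷ z₂ ∷ s' ∷ t' ∷ z₂' ∷ []) → (z₂ xor z₂') xor ((s xor s') xor (t xor t')) })
  (λ { (s ∷ t ∷ z₂ ∷ s' ∷ t' ∷ z₂' ∷ []) → (z₂ xor (s xor t)) xor (z₂' xor (s' xor t')) })
  (s ∷ t ∷ z₂ ∷ s' ∷ t' ∷ z₂' ∷ [])

gadget-xor-gadget : ∀ a E a' E' v v' → usesH v' ≡ usesH v →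
  gadget a E v xor gadget a' E' v' ≡ (a xor a') xor ((usesH v ∧ (E xor E')) xor (q v xor q v'))
gadget-xor-gadget a E a' E' v v' same rewrite same = ≡-exhaustive BP._≟_ 7
  (λ { (a ∷ E ∷ a' ∷ E' ∷ σ ∷ p ∷ p' ∷ []) → (a xor ((σ ∧ E) xor p)) xor (a' xor ((σ ∧ E') xor p')) })
  (λ { (a ∷ E ∷ a' ∷ E' ∷ σ ∷ p ∷ p' ∷ []) → (a xor a') xor ((σ ∧ (E xor E')) xor (p xor p')) })
  (a ∷ E ∷ a' ∷ E' ∷ usesH v ∷ q v ∷ q v' ∷ [])

gadget-balanced : ∀ a E → ∑ 4 (λ v → sgn (gadget a E v)) ≡ + 0
gadget-balanced a E = ≡-exhaustive ℤ._≟_ 2 (λ { (a ∷ E ∷ []) → ∑ 4 (λ v → sgn (gadget a E v)) }) (λ _ → + 0) (a ∷ E ∷ [])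

-- The hypothesis on αv is moved under an `if` so that the claim becomes a closed identity in
-- Boolean variables, decided by evaluation.
gadget-Δ-usesH : ∀ αv a E a' E' → usesH αv ≡ true → ∑ 4 (λ v → sgn (gadget a E v xor gadget a' E' (v ⊕ αv))) ≡ + 0
gadget-Δ-usesH αv a E a' E' σ = subst (λ b → (if b then ∑ 4 (λ v → sgn (gadget a E v xor gadget a' E' (v ⊕ αv))) else + 0) ≡ + 0) σ
  (checked αv a E a' E')
  where
  checked : ∀ αv a E a' E' → (if usesH αv then ∑ 4 (λ v → sgn (gadget a E v xor gadget a' E' (v ⊕ αv))) else + 0) ≡ + 0
  checked (s ∷ t ∷ z₁ ∷ z₂ ∷ []) a E a' E' = ≡-exhaustive ℤ._≟_ 8
    (λ { (s ∷ t ∷ z₁ ∷ z₂ ∷ a ∷ E ∷ a' ∷ E' ∷ []) → let αv = s ∷ t ∷ z₁ ∷ z₂ ∷ [] in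
         (if usesH αv then ∑ 4 (λ v → sgn (gadget a E v xor gadget a' E' (v ⊕ αv))) else + 0) })
    (λ _ → + 0) (s ∷ t ∷ z₁ ∷ z₂ ∷ a ∷ E ∷ a' ∷ E' ∷ [])

gadgetΔ-usesH : ∀ αv δ → usesH αv ≡ true → gadgetΔ αv δ ≡ + 0
gadgetΔ-usesH αv δ = gadget-Δ-usesH αv false false false δ

gadget-Δ-shift : ∀ αv a E b δ → usesH αv ≡ false →
  ∑ 4 (λ v → sgn (gadget a E v xor gadget (a xor b) (E xor δ) (v ⊕ αv))) ≡ sgn b *ℤ gadgetΔ αv δ
gadget-Δ-shift αv a E b δ σ =
  subst (λ x → (if x then + 0 else ∑ 4 (λ v → sgn (gadget a E v xor gadget (a xor b) (E xor δ) (v ⊕ αv))))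
             ≡ (if x then + 0 else sgn b *ℤ gadgetΔ αv δ)) σ (checked αv a E b δ)
  where
  checked : ∀ αv a E b δ → (if usesH αv then + 0 else ∑ 4 (λ v → sgn (gadget a E v xor gadget (a xor b) (E xor δ) (v ⊕ αv))))
                         ≡ (if usesH αv then + 0 else sgn b *ℤ gadgetΔ αv δ)
  checked (s ∷ t ∷ z₁ ∷ z₂ ∷ []) a E b δ = ≡-exhaustive ℤ._≟_ 8
    (λ { (s ∷ t ∷ z₁ ∷ z₂ ∷ a ∷ E ∷ b ∷ δ ∷ []) → let αv = s ∷ t ∷ z₁ ∷ z₂ ∷ [] in
         (if usesH αv then + 0 else ∑ 4 (λ v → sgn (gadget a E v xor gadget (a xor b) (E xor δ) (v ⊕ αv)))) })
    (λ { (s ∷ t ∷ z₁ ∷ z₂ ∷ a ∷ E ∷ b ∷ δ ∷ []) → let αv = s ∷ t ∷ z₁ ∷ z₂ ∷ [] in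
         (if usesH αv then + 0 else sgn b *ℤ gadgetΔ αv δ) })
    (s ∷ t ∷ z₁ ∷ z₂ ∷ a ∷ E ∷ b ∷ δ ∷ [])

∑-gadgetΔ² : ∀ δ → ∑ 4 (λ αv → gadgetΔ αv δ *ℤ gadgetΔ αv δ) ≡ + 1024
∑-gadgetΔ² false = refl
∑-gadgetΔ² true = refl

gadgetΔ-unit : ∀ αv → vweight αv ≡ 1 → gadgetΔ αv false ≡ + 0
gadgetΔ-unit (true ∷ false ∷ false ∷ false ∷ []) _ = refl
gadgetΔ-unit (false ∷ true ∷ false ∷ false ∷ []) _ = refl
gadgetΔ-unit (false ∷ false ∷ true ∷ false ∷ []) _ = refl
gadgetΔ-unit (false ∷ false ∷ false ∷ true ∷ []) _ = refl
gadgetΔ-unit (false ∷ false ∷ false ∷ false ∷ []) ()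
gadgetΔ-unit (false ∷ false ∷ true ∷ true ∷ []) ()
gadgetΔ-unit (false ∷ true ∷ false ∷ true ∷ []) ()
gadgetΔ-unit (false ∷ true ∷ true ∷ false ∷ []) ()
gadgetΔ-unit (false ∷ true ∷ true ∷ true ∷ []) ()
gadgetΔ-unit (true ∷ false ∷ false ∷ true ∷ []) ()
gadgetΔ-unit (true ∷ false ∷ true ∷ false ∷ []) ()
gadgetΔ-unit (true ∷ false ∷ true ∷ true ∷ []) ()
gadgetΔ-unit (true ∷ true ∷ false ∷ false ∷ []) ()
gadgetΔ-unit (true ∷ true ∷ false ∷ true ∷ []) ()
gadgetΔ-unit (true ∷ true ∷ true ∷ false ∷ []) ()
gadgetΔ-unit (true ∷ true ∷ true ∷ true ∷ []) ()

-- The sign of (F ⊕ ℓ)(v, u, w) for an affine ℓ separates into a factor depending on w and one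
-- depending on v; which w-factor occurs is decided by usesH v.
sgn-gadget-split : ∀ σ qv bv·v au·w e·w bw·w cu bu·u k →
  sgn (((au·w xor cu) xor ((σ ∧ e·w) xor qv)) xor ((bv·v xor (bu·u xor bw·w)) xor k))
  ≡ sgn (au·w xor bw·w) *ℤ unless (σ xor false) (sgn ((qv xor bv·v) xor ((cu xor bu·u) xor k)))
    +ℤ sgn ((au·w xor e·w) xor bw·w) *ℤ unless (σ xor true) (sgn ((qv xor bv·v) xor ((cu xor bu·u) xor k)))
sgn-gadget-split σ qv bv·v au·w e·w bw·w cu bu·u k = ≡-exhaustive ℤ._≟_ 9
  (λ { (σ ∷ p ∷ d ∷ x ∷ E ∷ y ∷ c ∷ z ∷ k ∷ []) → sgn (((x xor c) xor ((σ ∧ E) xor p)) xor ((d xor (z xor y)) xor k)) })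
  (λ { (σ ∷ p ∷ d ∷ x ∷ E ∷ y ∷ c ∷ z ∷ k ∷ []) →
    sgn (x xor y) *ℤ unless (σ xor false) (sgn ((p xor d) xor ((c xor z) xor k)))
    +ℤ sgn ((x xor E) xor y) *ℤ unless (σ xor true) (sgn ((p xor d) xor ((c xor z) xor k))) })
  (σ ∷ qv ∷ bv·v ∷ au·w ∷ e·w ∷ bw·w ∷ cu ∷ bu·u ∷ k ∷ [])

∑-onUsesH-sgn-xor : ∀ bv j k → ∑ 4 (λ v → onUsesH j v (sgn ((q v xor dot bv v) xor k))) ≡ sgn k *ℤ gadgetW bv j
∑-onUsesH-sgn-xor bv j k = begin
    ∑ 4 (λ v → onUsesH j v (sgn ((q v xor dot bv v) xor k)))
  ≡⟨ ∑-cong 4 (λ v → unless-sgn-xor (usesH v xor j) (q v xor dot bv v)) ⟩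
    ∑ 4 (λ v → onUsesH j v (sgn (q v xor dot bv v)) *ℤ sgn k)
  ≡⟨ ∑-*ʳ 4 (sgn k) (λ v → onUsesH j v (sgn (q v xor dot bv v))) ⟩
    gadgetW bv j *ℤ sgn k
  ≡⟨ ℤP.*-comm (gadgetW bv j) (sgn k) ⟩
    sgn k *ℤ gadgetW bv j ∎
  where
  open ≡-Reasoning
  unless-sgn-xor : ∀ b x → unless b (sgn (x xor k)) ≡ unless b (sgn x) *ℤ sgn k
  unless-sgn-xor true x = sym (ℤP.*-zeroˡ (sgn k))
  unless-sgn-xor false x = sgn-xor x k

i≤+∣i∣ : ∀ i → i ≤ℤ + ℤ.∣ i ∣
i≤+∣i∣ (+ n) = ℤP.≤-refl
i≤+∣i∣ ℤ.-[1+ n ] = ℤ.-≤+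

sgn*≤∣∣ : ∀ k i → sgn k *ℤ i ≤ℤ + ℤ.∣ i ∣
sgn*≤∣∣ false i = subst (_≤ℤ + ℤ.∣ i ∣) (sym (ℤP.*-identityˡ i)) (i≤+∣i∣ i)
sgn*≤∣∣ true i = subst₂ _≤ℤ_ (sym (ℤP.-1*i≡-i i)) (cong +_ (ℤP.∣-i∣≡∣i∣ i)) (i≤+∣i∣ (- i))

∣gadgetW∣-sum : ∀ bv → ∣gadgetW∣ bv false +ℤ ∣gadgetW∣ bv true ≤ℤ + 8
∣gadgetW∣-sum (s ∷ t ∷ z₁ ∷ z₂ ∷ []) = ≤ℤ-exhaustive 4
  (λ { (s ∷ t ∷ z₁ ∷ z₂ ∷ []) → ∣gadgetW∣ (s ∷ t ∷ z₁ ∷ z₂ ∷ []) false +ℤ ∣gadgetW∣ (s ∷ t ∷ z₁ ∷ z₂ ∷ []) true })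
  (λ _ → + 8) (s ∷ t ∷ z₁ ∷ z₂ ∷ [])

xor-rightComm : ∀ x y z → (x xor y) xor z ≡ (x xor z) xor y
xor-rightComm x y z = ≡-exhaustive BP._≟_ 3 (λ { (x ∷ y ∷ z ∷ []) → (x xor y) xor z })
                                            (λ { (x ∷ y ∷ z ∷ []) → (x xor z) xor y }) (x ∷ y ∷ z ∷ [])

affineFun-shift : ∀ {m} (a : Vec Bool m) c w α → affineFun a c (w ⊕ α) ≡ affineFun a c w xor dot a α
affineFun-shift a c w α = trans (cong (_xor c) (dot-⊕ʳ a w α)) (xor-rightComm (dot a w) (dot a α) c)

affineFun-⊕ : ∀ {m} (a b : Vec Bool m) c w → affineFun (a ⊕ b) c w ≡ affineFun a c w xor dot b w
affineFun-⊕ a b c w = trans (cong (_xor c) (dot-⊕ˡ a b w)) (xor-rightComm (dot a w) (dot b w) c)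

affineFun-xor-shift : ∀ {m} (a a' : Vec Bool m) c c' w α →
  affineFun a c w xor affineFun a' c' (w ⊕ α) ≡ dot (a ⊕ a') w xor ((c xor c') xor dot a' α)
affineFun-xor-shift a a' c c' w α = begin
    (dot a w xor c) xor affineFun a' c' (w ⊕ α)
  ≡⟨ cong ((dot a w xor c) xor_) (affineFun-shift a' c' w α) ⟩
    (dot a w xor c) xor ((dot a' w xor c') xor dot a' α)
  ≡⟨ ≡-exhaustive BP._≟_ 5 (λ { (x ∷ c ∷ y ∷ c' ∷ z ∷ []) → (x xor c) xor ((y xor c') xor z) })
                           (λ { (x ∷ c ∷ y ∷ c' ∷ z ∷ []) → (x xor y) xor ((c xor c') xor z) })
                           (dot a w ∷ c ∷ dot a' w ∷ c' ∷ dot a' α ∷ []) ⟩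
    (dot a w xor dot a' w) xor ((c xor c') xor dot a' α)
  ≡⟨ cong (_xor ((c xor c') xor dot a' α)) (sym (dot-⊕ˡ a a' w)) ⟩
    dot (a ⊕ a') w xor ((c xor c') xor dot a' α) ∎
  where open ≡-Reasoning

∑-sgn-dot-xor : ∀ m (p : Vec Bool m) k → ∑ m (λ w → sgn (dot p w xor k)) ≡ δ₀ p *ℤ sgn k
∑-sgn-dot-xor m p k = trans (∑-cong m (λ w → sgn-xor (dot p w) k))
                            (trans (∑-*ʳ m (sgn k) (λ w → sgn (dot p w))) (cong (_*ℤ sgn k) (∑-sgn-dot m p)))

take-++ : ∀ {A : Set} r {p} (u : Vec A r) (z : Vec A p) → take r (u ++ z) ≡ u
take-++ r u z = sym (VP.++-injectiveˡ u _ (proj₂ (proj₂ (splitAt r (u ++ z)))))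

drop-++ : ∀ {A : Set} r {p} (u : Vec A r) (z : Vec A p) → drop r (u ++ z) ≡ z
drop-++ r u z = sym (VP.++-injectiveʳ u _ (proj₂ (proj₂ (splitAt r (u ++ z)))))

vweight-++ : ∀ {p q} (a : Vec Bool p) (b : Vec Bool q) → vweight (a ++ b) ≡ vweight a + vweight b
vweight-++ [] b = refl
vweight-++ (false ∷ a) b = vweight-++ a b
vweight-++ (true ∷ a) b = cong suc (vweight-++ a b)

+≡1 : ∀ a b → a + b ≡ 1 → (a ≡ 1 × b ≡ 0) ⊎ (a ≡ 0 × b ≡ 1)
+≡1 zero b e = inj₂ (refl , e)
+≡1 (suc zero) zero _ = inj₁ (refl , refl)
+≡1 (suc zero) (suc b) ()
+≡1 (suc (suc a)) b ()

N-lower-bound : ∀ {n} (f : BoolFun n) {b} → b ≤ 2 ^ n → (∀ a c → b ≤ dist f (affineFun a c)) → b ≤ N f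
N-lower-bound {n} f {b} b≤2ⁿ b≤dist = go (affines n)
  where
  go : ∀ l → b ≤ foldr (λ ac r → dist f (affineFun (proj₁ ac) (proj₂ ac)) ⊓ r) (2 ^ n) l
  go L.[] = b≤2ⁿ
  go ((a , c) L.∷ l) = ℕP.⊓-glb (b≤dist a c) (go l)

module NormalForm (r m : ℕ) (a : Vec Bool r → Vec Bool m) (c : Vec Bool r → Bool) (e : Vec Bool m)
                  (a-injective : ∀ u u' → a u ≡ a u' → u ≡ u') where

  n : ℕ
  n = 2 + (r + (2 + m))

  glue : Vec Bool 4 → Vec Bool r → Vec Bool m → Vec Bool n
  glue (s ∷ t ∷ z₁ ∷ z₂ ∷ []) u w = s ∷ t ∷ (u ++ (z₁ ∷ z₂ ∷ w))

  F′ : Vec Bool 4 → Vec Bool r → Vec Bool m → Bool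
  F′ v u w = gadget (affineFun (a u) (c u) w) (dot e w) v

  F : Vec Bool n → Bool
  F (s ∷ t ∷ x) with drop r x
  ... | z₁ ∷ z₂ ∷ w = F′ (s ∷ t ∷ z₁ ∷ z₂ ∷ []) (take r x) w

  F-glue : ∀ v u w → F (glue v u w) ≡ F′ v u w
  F-glue (s ∷ t ∷ z₁ ∷ z₂ ∷ []) u w rewrite drop-++ r u (z₁ ∷ z₂ ∷ w) | take-++ r u (z₁ ∷ z₂ ∷ w) = refl

  glue-surjective : ∀ x → Σ (Vec Bool 4) λ v → Σ (Vec Bool r) λ u → Σ (Vec Bool m) λ w → x ≡ glue v u w
  glue-surjective (s ∷ t ∷ x) with drop r x in eq
  ... | z₁ ∷ z₂ ∷ w = s ∷ t ∷ z₁ ∷ z₂ ∷ [] , take r x , w ,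
        cong (λ y → s ∷ t ∷ y) (trans (sym (VP.take++drop≡id r x)) (cong (take r x ++_) eq))

  glue-⊕ : ∀ v u w v' u' w' → glue v u w ⊕ glue v' u' w' ≡ glue (v ⊕ v') (u ⊕ u') (w ⊕ w')
  glue-⊕ (s ∷ t ∷ z₁ ∷ z₂ ∷ []) u w (s' ∷ t' ∷ z₁' ∷ z₂' ∷ []) u' w' =
    cong (λ y → (s xor s') ∷ (t xor t') ∷ y) (VP.zipWith-++ _xor_ u (z₁ ∷ z₂ ∷ w) u' (z₁' ∷ z₂' ∷ w'))

  ∑-glue : ∀ (H : Vec Bool n → ℤ) → ∑ n H ≡ ∑ r (λ u → ∑ m (λ w → ∑ 4 (λ v → H (glue v u w))))
  ∑-glue H = begin
      ∑ n H
    ≡⟨ ∑-++ 2 H ⟩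
      ∑ 2 (λ st → ∑ (r + (2 + m)) (λ x → H (st ++ x)))
    ≡⟨ ∑-cong 2 (λ st → ∑-++ r (λ x → H (st ++ x))) ⟩
      ∑ 2 (λ st → ∑ r (λ u → ∑ (2 + m) (λ z → H (st ++ (u ++ z)))))
    ≡⟨ ∑-cong 2 (λ st → ∑-cong r (λ u → ∑-++ 2 (λ z → H (st ++ (u ++ z))))) ⟩
      ∑ 2 (λ st → ∑ r (λ u → ∑ 2 (λ z → ∑ m (λ w → H (st ++ (u ++ (z ++ w)))))))
    ≡⟨ ∑-comm 2 r (λ st u → ∑ 2 (λ z → ∑ m (λ w → H (st ++ (u ++ (z ++ w)))))) ⟩
      ∑ r (λ u → ∑ 2 (λ st → ∑ 2 (λ z → ∑ m (λ w → H (st ++ (u ++ (z ++ w)))))))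
    ≡⟨ ∑-cong r (λ u → ∑-cong 2 (λ st → ∑-comm 2 m (λ z w → H (st ++ (u ++ (z ++ w)))))) ⟩
      ∑ r (λ u → ∑ 2 (λ st → ∑ m (λ w → ∑ 2 (λ z → H (st ++ (u ++ (z ++ w)))))))
    ≡⟨ ∑-cong r (λ u → ∑-comm 2 m (λ st w → ∑ 2 (λ z → H (st ++ (u ++ (z ++ w)))))) ⟩
      ∑ r (λ u → ∑ m (λ w → ∑ 4 (λ v → H (glue v u w)))) ∎
    where open ≡-Reasoning

  balanced : Balanced (tt F)
  balanced = ℤP.+-injective (begin
      + (2 * weight (tt F))
    ≡⟨ sym (ℤP.+-identityˡ _) ⟩
      + 0 +ℤ + (2 * weight (tt F))
    ≡⟨ cong (_+ℤ + (2 * weight (tt F))) (sym sum-sgn) ⟩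
      sumℤ (map sgn (tt F)) +ℤ + (2 * weight (tt F))
    ≡⟨ sumℤ-sgn+2*weight (tt F) ⟩
      + length (tt F) ∎)
    where
    open ≡-Reasoning
    sum-sgn : sumℤ (map sgn (tt F)) ≡ + 0
    sum-sgn = begin
        sumℤ (map sgn (map F (points n)))
      ≡⟨ cong sumℤ (sym (LP.map-∘ (points n))) ⟩
        sumℤ (map (λ x → sgn (F x)) (points n))
      ≡⟨ sumℤ-points n (λ x → sgn (F x)) ⟩
        ∑ n (λ x → sgn (F x))
      ≡⟨ ∑-glue (λ x → sgn (F x)) ⟩
        ∑ r (λ u → ∑ m (λ w → ∑ 4 (λ v → sgn (F (glue v u w)))))
      ≡⟨ ∑-cong r (λ u → ∑-cong m (λ w → trans (∑-cong 4 (λ v → cong sgn (F-glue v u w)))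
                                                (gadget-balanced (affineFun (a u) (c u) w) (dot e w)))) ⟩
        ∑ r (λ u → ∑ m (λ w → + 0))
      ≡⟨ trans (∑-cong r (λ u → ∑-zero m)) (∑-zero r) ⟩
        + 0 ∎

  charSum : Vec Bool m → ℤ
  charSum αw = ∑ r (λ u → sgn (dot (a u) αw))

  autocorrelation₀ : Vec Bool 4 → Vec Bool m → ℤ
  autocorrelation₀ αv αw = (+ (2 ^ m) *ℤ gadgetΔ αv (dot e αw)) *ℤ charSum αw

  autocorrelation : Vec Bool 4 → Vec Bool r → Vec Bool m → ℤ
  autocorrelation αv αu αw = if isZero αu then autocorrelation₀ αv αw else + 0

  ∑Δ : Vec Bool 4 → Vec Bool r → Vec Bool m → ℤ
  ∑Δ αv αu αw = ∑ r (λ u → ∑ m (λ w → ∑ 4 (λ v → sgn (F′ v u w xor F′ (v ⊕ αv) (u ⊕ αu) (w ⊕ αw)))))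

  Δ-glue-∑ : ∀ αv αu αw → Δ F (glue αv αu αw) ≡ ∑Δ αv αu αw
  Δ-glue-∑ αv αu αw = begin
      Δ F (glue αv αu αw)
    ≡⟨ sumℤ-points n (λ x → sgn (F x) *ℤ sgn (F (x ⊕ glue αv αu αw))) ⟩
      ∑ n (λ x → sgn (F x) *ℤ sgn (F (x ⊕ glue αv αu αw)))
    ≡⟨ ∑-glue (λ x → sgn (F x) *ℤ sgn (F (x ⊕ glue αv αu αw))) ⟩
      ∑ r (λ u → ∑ m (λ w → ∑ 4 (λ v → sgn (F (glue v u w)) *ℤ sgn (F (glue v u w ⊕ glue αv αu αw)))))
    ≡⟨ ∑-cong r (λ u → ∑-cong m (λ w → ∑-cong 4 (λ v → pointwise u w v))) ⟩
      ∑Δ αv αu αw ∎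
    where
    open ≡-Reasoning
    pointwise : ∀ u w v → sgn (F (glue v u w)) *ℤ sgn (F (glue v u w ⊕ glue αv αu αw))
                        ≡ sgn (F′ v u w xor F′ (v ⊕ αv) (u ⊕ αu) (w ⊕ αw))
    pointwise u w v = begin
        sgn (F (glue v u w)) *ℤ sgn (F (glue v u w ⊕ glue αv αu αw))
      ≡⟨ cong₂ (λ x y → sgn x *ℤ sgn y) (F-glue v u w) (trans (cong F (glue-⊕ v u w αv αu αw)) (F-glue (v ⊕ αv) (u ⊕ αu) (w ⊕ αw))) ⟩
        sgn (F′ v u w) *ℤ sgn (F′ (v ⊕ αv) (u ⊕ αu) (w ⊕ αw))
      ≡⟨ sym (sgn-xor (F′ v u w) _) ⟩
        sgn (F′ v u w xor F′ (v ⊕ αv) (u ⊕ αu) (w ⊕ αw)) ∎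

  ∑Δ-usesH : ∀ αv αu αw → usesH αv ≡ true → ∑Δ αv αu αw ≡ + 0
  ∑Δ-usesH αv αu αw σ = trans (∑-cong r (λ u → trans (∑-cong m (λ w → inner u w)) (∑-zero m))) (∑-zero r)
    where
    inner : ∀ u w → ∑ 4 (λ v → sgn (F′ v u w xor F′ (v ⊕ αv) (u ⊕ αu) (w ⊕ αw))) ≡ + 0
    inner u w = gadget-Δ-usesH αv (affineFun (a u) (c u) w) (dot e w) (affineFun (a (u ⊕ αu)) (c (u ⊕ αu)) (w ⊕ αw)) (dot e (w ⊕ αw)) σ

  isZero-a⊕a : ∀ u u' → isZero (a u ⊕ a u') ≡ isZero (u ⊕ u')
  isZero-a⊕a u u' with isZero (u ⊕ u') in z
  ... | true rewrite ≡-from-isZero-⊕ u u' z = isZero-⊕-self (a u')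
  ... | false with isZero (a u ⊕ a u') in z′
  ... | false = refl
  ... | true with trans (sym (isZero-⊕-self u)) (trans (cong (λ x → isZero (u ⊕ x)) (a-injective u u' (≡-from-isZero-⊕ _ _ z′))) z)
  ... | ()

  δ₀-a⊕a : ∀ u u' → δ₀ (a u ⊕ a u') ≡ (if isZero (u ⊕ u') then + (2 ^ m) else + 0)
  δ₀-a⊕a u u' = cong (λ b → if b then + (2 ^ m) else + 0) (isZero-a⊕a u u')

  δ₀-a⊕a-shift : ∀ u αu → isZero αu ≡ false → δ₀ (a u ⊕ a (u ⊕ αu)) ≡ + 0
  δ₀-a⊕a-shift u αu αu≢0 = trans (δ₀-a⊕a u (u ⊕ αu)) (cong (λ b → if b then + (2 ^ m) else + 0) (trans u⊕u⊕αu αu≢0))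
    where
    u⊕u⊕αu : isZero (u ⊕ (u ⊕ αu)) ≡ isZero αu
    u⊕u⊕αu = cong isZero (trans (sym (⊕-assoc u u αu)) (trans (cong (_⊕ αu) (⊕-self u)) (⊕-identityˡ αu)))

  ∑Δ-nonzero-shift : ∀ αv αu αw → usesH αv ≡ false → isZero αu ≡ false → ∑Δ αv αu αw ≡ + 0
  ∑Δ-nonzero-shift αv αu αw σ αu≢0 =
    trans (∑-cong r (λ u → trans (∑-comm m 4 (λ w v → sgn (F′ v u w xor F′ (v ⊕ αv) (u ⊕ αu) (w ⊕ αw))))
                                 (trans (∑-cong 4 (λ v → ∑-w u v)) (∑-zero 4))))
          (∑-zero r)
    where
    usesH-same : ∀ v → usesH (v ⊕ αv) ≡ usesH v
    usesH-same v = trans (usesH-⊕ v αv) (trans (cong (usesH v xor_) σ) (BP.xor-identityʳ (usesH v)))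
    ∑-w : ∀ u v → ∑ m (λ w → sgn (F′ v u w xor F′ (v ⊕ αv) (u ⊕ αu) (w ⊕ αw))) ≡ + 0
    ∑-w u v = begin
        ∑ m (λ w → sgn (F′ v u w xor F′ (v ⊕ αv) u' (w ⊕ αw)))
      ≡⟨ ∑-cong m (λ w → cong sgn (pointwise w)) ⟩
        ∑ m (λ w → sgn (dot (a u ⊕ a u') w xor K))
      ≡⟨ ∑-sgn-dot-xor m (a u ⊕ a u') K ⟩
        δ₀ (a u ⊕ a u') *ℤ sgn K
      ≡⟨ cong (_*ℤ sgn K) (δ₀-a⊕a-shift u αu αu≢0) ⟩
        + 0 *ℤ sgn K
      ≡⟨ ℤP.*-zeroˡ (sgn K) ⟩
        + 0 ∎
      where
      open ≡-Reasoning
      u' = u ⊕ αu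
      K = ((c u xor c u') xor dot (a u') αw) xor ((usesH v ∧ dot e αw) xor (q v xor q (v ⊕ αv)))
      pointwise : ∀ w → F′ v u w xor F′ (v ⊕ αv) u' (w ⊕ αw) ≡ dot (a u ⊕ a u') w xor K
      pointwise w = begin
          F′ v u w xor F′ (v ⊕ αv) u' (w ⊕ αw)
        ≡⟨ gadget-xor-gadget (affineFun (a u) (c u) w) (dot e w) (affineFun (a u') (c u') (w ⊕ αw)) (dot e (w ⊕ αw))
                             v (v ⊕ αv) (usesH-same v) ⟩
          (affineFun (a u) (c u) w xor affineFun (a u') (c u') (w ⊕ αw))
            xor ((usesH v ∧ (dot e w xor dot e (w ⊕ αw))) xor (q v xor q (v ⊕ αv)))
        ≡⟨ cong₂ (λ x y → x xor ((usesH v ∧ y) xor (q v xor q (v ⊕ αv))))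
             (affineFun-xor-shift (a u) (a u') (c u) (c u') w αw) (dot-xor-dot-⊕ e w αw) ⟩
          (dot (a u ⊕ a u') w xor ((c u xor c u') xor dot (a u') αw))
            xor ((usesH v ∧ dot e αw) xor (q v xor q (v ⊕ αv)))
        ≡⟨ BP.xor-assoc (dot (a u ⊕ a u') w) _ _ ⟩
          dot (a u ⊕ a u') w xor K ∎

  ∑Δ-zero-shift : ∀ αv αw → usesH αv ≡ false →
    ∑Δ αv (zeros r) αw ≡ autocorrelation₀ αv αw
  ∑Δ-zero-shift αv αw σ = begin
      ∑Δ αv (zeros r) αw
    ≡⟨ ∑-cong r (λ u → ∑-cong m (λ w → ∑-v u w)) ⟩
      ∑ r (λ u → ∑ m (λ w → sgn (dot (a u) αw) *ℤ T))
    ≡⟨ ∑-cong r (λ u → ∑-const m (sgn (dot (a u) αw) *ℤ T)) ⟩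
      ∑ r (λ u → + (2 ^ m) *ℤ (sgn (dot (a u) αw) *ℤ T))
    ≡⟨ ∑-cong r (λ u → reorder (+ (2 ^ m)) (sgn (dot (a u) αw)) T) ⟩
      ∑ r (λ u → (+ (2 ^ m) *ℤ T) *ℤ sgn (dot (a u) αw))
    ≡⟨ ∑-*ˡ r (+ (2 ^ m) *ℤ T) (λ u → sgn (dot (a u) αw)) ⟩
      (+ (2 ^ m) *ℤ T) *ℤ charSum αw ∎
    where
    open ≡-Reasoning
    T = gadgetΔ αv (dot e αw)
    reorder : ∀ x y z → x *ℤ (y *ℤ z) ≡ (x *ℤ z) *ℤ y
    reorder = solve-∀
    ∑-v : ∀ u w → ∑ 4 (λ v → sgn (F′ v u w xor F′ (v ⊕ αv) (u ⊕ zeros r) (w ⊕ αw))) ≡ sgn (dot (a u) αw) *ℤ T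
    ∑-v u w = begin
        ∑ 4 (λ v → sgn (F′ v u w xor F′ (v ⊕ αv) (u ⊕ zeros r) (w ⊕ αw)))
      ≡⟨ ∑-cong 4 (λ v → cong (λ u' → sgn (F′ v u w xor F′ (v ⊕ αv) u' (w ⊕ αw))) (⊕-identityʳ u)) ⟩
        ∑ 4 (λ v → sgn (F′ v u w xor gadget (affineFun (a u) (c u) (w ⊕ αw)) (dot e (w ⊕ αw)) (v ⊕ αv)))
      ≡⟨ ∑-cong 4 (λ v → cong₂ (λ x y → sgn (F′ v u w xor gadget x y (v ⊕ αv)))
                               (affineFun-shift (a u) (c u) w αw) (dot-⊕ʳ e w αw)) ⟩
        ∑ 4 (λ v → sgn (F′ v u w xor gadget (affineFun (a u) (c u) w xor dot (a u) αw) (dot e w xor dot e αw) (v ⊕ αv)))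
      ≡⟨ gadget-Δ-shift αv (affineFun (a u) (c u) w) (dot e w) (dot (a u) αw) (dot e αw) σ ⟩
        sgn (dot (a u) αw) *ℤ T ∎

  autocorrelation₀≡0 : ∀ {αv αw} → gadgetΔ αv (dot e αw) ≡ + 0 ⊎ charSum αw ≡ + 0 → autocorrelation₀ αv αw ≡ + 0
  autocorrelation₀≡0 {αv} {αw} (inj₁ T≡0) = begin
      autocorrelation₀ αv αw           ≡⟨ cong (λ x → (+ (2 ^ m) *ℤ x) *ℤ charSum αw) T≡0 ⟩
      (+ (2 ^ m) *ℤ + 0) *ℤ charSum αw ≡⟨ cong (_*ℤ charSum αw) (ℤP.*-zeroʳ (+ (2 ^ m))) ⟩
      + 0 *ℤ charSum αw                ≡⟨ ℤP.*-zeroˡ (charSum αw) ⟩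
      + 0                              ∎
    where open ≡-Reasoning
  autocorrelation₀≡0 {αv} {αw} (inj₂ S≡0) = trans (cong ((+ (2 ^ m) *ℤ gadgetΔ αv (dot e αw)) *ℤ_) S≡0) (ℤP.*-zeroʳ (+ (2 ^ m) *ℤ gadgetΔ αv (dot e αw)))

  autocorrelation-usesH : ∀ αv αu αw → usesH αv ≡ true → autocorrelation αv αu αw ≡ + 0
  autocorrelation-usesH αv αu αw σ with isZero αu
  ... | false = refl
  ... | true = autocorrelation₀≡0 {αv} {αw} (inj₁ (gadgetΔ-usesH αv (dot e αw) σ))

  Δ-glue : ∀ αv αu αw → Δ F (glue αv αu αw) ≡ autocorrelation αv αu αw
  Δ-glue αv αu αw = trans (Δ-glue-∑ αv αu αw) (by-cases (usesH αv) refl (isZero αu) refl)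
    where
    open ≡-Reasoning
    by-cases : ∀ b → usesH αv ≡ b → ∀ z → isZero αu ≡ z → ∑Δ αv αu αw ≡ autocorrelation αv αu αw
    by-cases true σ _ _ = trans (∑Δ-usesH αv αu αw σ) (sym (autocorrelation-usesH αv αu αw σ))
    by-cases false σ false z = trans (∑Δ-nonzero-shift αv αu αw σ z) (cong (λ b → if b then autocorrelation₀ αv αw else + 0) (sym z))
    by-cases false σ true z = begin
        ∑Δ αv αu αw
      ≡⟨ cong (λ x → ∑Δ αv x αw) (isZero⇒≡zeros αu z) ⟩
        ∑Δ αv (zeros r) αw
      ≡⟨ ∑Δ-zero-shift αv αw σ ⟩
        autocorrelation₀ αv αw
      ≡⟨ cong (λ b → if b then autocorrelation₀ αv αw else + 0) (sym z) ⟩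
        autocorrelation αv αu αw ∎

  vweight-glue : ∀ v u w → vweight (glue v u w) ≡ vweight v + (vweight u + vweight w)
  vweight-glue (s ∷ t ∷ z₁ ∷ z₂ ∷ []) u w =
    trans (cong (λ k → bit s + (bit t + k)) (vweight-++ u (z₁ ∷ z₂ ∷ w)))
          (reorder (bit s) (bit t) (bit z₁) (bit z₂) (vweight u) (vweight w))
    where
    bit : Bool → ℕ
    bit b = if b then 1 else 0
    reorder : ∀ a b c d U W → a + (b + (U + (c + (d + W)))) ≡ (a + (b + (c + (d + 0)))) + (U + W)
    reorder = NS.solve-∀

  CharSumVanishesOnUnits : Set
  CharSumVanishesOnUnits = ∀ αw → vweight αw ≡ 1 → dot e αw ≡ false → charSum αw ≡ + 0

  autocorrelation-unit : CharSumVanishesOnUnits → ∀ αv αu αw → vweight (glue αv αu αw) ≡ 1 →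
    autocorrelation αv αu αw ≡ + 0
  autocorrelation-unit hS αv αu αw unit with isZero αu in z
  ... | false = refl
  ... | true with +≡1 (vweight αv) (vweight αw) weights
    where
    weights : vweight αv + vweight αw ≡ 1
    weights = trans (cong (λ k → vweight αv + (k + vweight αw))
                          (sym (trans (cong vweight (isZero⇒≡zeros αu z)) (vweight-zeros r))))
                    (trans (sym (vweight-glue αv αu αw)) unit)
  ... | inj₁ (αv-unit , αw-zero) = autocorrelation₀≡0 {αv} {αw} (inj₁ (begin
      gadgetΔ αv (dot e αw)
    ≡⟨ cong (λ x → gadgetΔ αv (dot e x)) (isZero⇒≡zeros αw (vweight≡0⇒isZero αw αw-zero)) ⟩
      gadgetΔ αv (dot e (zeros m))
    ≡⟨ cong (gadgetΔ αv) (dot-zerosʳ e) ⟩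
      gadgetΔ αv false
    ≡⟨ gadgetΔ-unit αv αv-unit ⟩
      + 0 ∎))
    where open ≡-Reasoning
  ... | inj₂ (αv-zero , αw-unit) rewrite isZero⇒≡zeros αv (vweight≡0⇒isZero αv αv-zero) =
    autocorrelation₀≡0 {zeros 4} {αw} (by-e·αw (dot e αw) refl)
    where
    by-e·αw : ∀ b → dot e αw ≡ b → gadgetΔ (zeros 4) (dot e αw) ≡ + 0 ⊎ charSum αw ≡ + 0
    by-e·αw true e·αw≡1 = inj₁ (cong (gadgetΔ (zeros 4)) e·αw≡1)
    by-e·αw false e·αw≡0 = inj₂ (hS αw αw-unit e·αw≡0)

  sac : CharSumVanishesOnUnits → SAC F
  sac hS x unit with glue-surjective x
  ... | αv , αu , αw , refl = trans (Δ-glue αv αu αw) (autocorrelation-unit hS αv αu αw unit)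

  ∑-charSum² : ∑ m (λ αw → charSum αw *ℤ charSum αw) ≡ + (2 ^ r) *ℤ + (2 ^ m)
  ∑-charSum² = begin
      ∑ m (λ αw → charSum αw *ℤ charSum αw)
    ≡⟨ ∑-cong m (λ αw → expand αw) ⟩
      ∑ m (λ αw → ∑ r (λ u → ∑ r (λ u' → sgn (dot (a u ⊕ a u') αw))))
    ≡⟨ ∑-comm m r (λ αw u → ∑ r (λ u' → sgn (dot (a u ⊕ a u') αw))) ⟩
      ∑ r (λ u → ∑ m (λ αw → ∑ r (λ u' → sgn (dot (a u ⊕ a u') αw))))
    ≡⟨ ∑-cong r (λ u → ∑-comm m r (λ αw u' → sgn (dot (a u ⊕ a u') αw))) ⟩
      ∑ r (λ u → ∑ r (λ u' → ∑ m (λ αw → sgn (dot (a u ⊕ a u') αw))))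
    ≡⟨ ∑-cong r (λ u → ∑-cong r (λ u' → trans (∑-sgn-dot m (a u ⊕ a u')) (δ₀-a⊕a u u'))) ⟩
      ∑ r (λ u → ∑ r (λ u' → if isZero (u ⊕ u') then + (2 ^ m) else + 0))
    ≡⟨ ∑-cong r (λ u → ∑-δ r u (+ (2 ^ m))) ⟩
      ∑ r (λ _ → + (2 ^ m))
    ≡⟨ ∑-const r (+ (2 ^ m)) ⟩
      + (2 ^ r) *ℤ + (2 ^ m) ∎
    where
    open ≡-Reasoning
    expand : ∀ αw → charSum αw *ℤ charSum αw ≡ ∑ r (λ u → ∑ r (λ u' → sgn (dot (a u ⊕ a u') αw)))
    expand αw = begin
        charSum αw *ℤ charSum αw
      ≡⟨ ∑-*ʳ r (charSum αw) (λ u → sgn (dot (a u) αw)) ⟨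
        ∑ r (λ u → sgn (dot (a u) αw) *ℤ charSum αw)
      ≡⟨ ∑-cong r (λ u → ∑-*ˡ r (sgn (dot (a u) αw)) (λ u' → sgn (dot (a u') αw))) ⟨
        ∑ r (λ u → ∑ r (λ u' → sgn (dot (a u) αw) *ℤ sgn (dot (a u') αw)))
      ≡⟨ ∑-cong r (λ u → ∑-cong r (λ u' → trans (sym (sgn-xor (dot (a u) αw) (dot (a u') αw))) (cong sgn (sym (dot-⊕ˡ (a u) (a u') αw))))) ⟩
        ∑ r (λ u → ∑ r (λ u' → sgn (dot (a u ⊕ a u') αw))) ∎

  ∑-autocorrelation₀² : ∀ αw → ∑ 4 (λ αv → autocorrelation₀ αv αw *ℤ autocorrelation₀ αv αw)
                            ≡ ((+ (2 ^ m) *ℤ + (2 ^ m)) *ℤ + 1024) *ℤ (charSum αw *ℤ charSum αw)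
  ∑-autocorrelation₀² αw = begin
      ∑ 4 (λ αv → autocorrelation₀ αv αw *ℤ autocorrelation₀ αv αw)
    ≡⟨ ∑-cong 4 (λ αv → square (+ (2 ^ m)) (gadgetΔ αv (dot e αw)) (charSum αw)) ⟩
      ∑ 4 (λ αv → μ *ℤ (gadgetΔ αv (dot e αw) *ℤ gadgetΔ αv (dot e αw)))
    ≡⟨ ∑-*ˡ 4 μ (λ αv → gadgetΔ αv (dot e αw) *ℤ gadgetΔ αv (dot e αw)) ⟩
      μ *ℤ ∑ 4 (λ αv → gadgetΔ αv (dot e αw) *ℤ gadgetΔ αv (dot e αw))
    ≡⟨ cong (μ *ℤ_) (∑-gadgetΔ² (dot e αw)) ⟩
      μ *ℤ + 1024
    ≡⟨ reorder (+ (2 ^ m) *ℤ + (2 ^ m)) (charSum αw *ℤ charSum αw) (+ 1024) ⟩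
      ((+ (2 ^ m) *ℤ + (2 ^ m)) *ℤ + 1024) *ℤ (charSum αw *ℤ charSum αw) ∎
    where
    open ≡-Reasoning
    μ = (+ (2 ^ m) *ℤ + (2 ^ m)) *ℤ (charSum αw *ℤ charSum αw)
    square : ∀ x T S → ((x *ℤ T) *ℤ S) *ℤ ((x *ℤ T) *ℤ S) ≡ ((x *ℤ x) *ℤ (S *ℤ S)) *ℤ (T *ℤ T)
    square = solve-∀
    reorder : ∀ x y z → (x *ℤ y) *ℤ z ≡ (x *ℤ z) *ℤ y
    reorder = solve-∀

  σ-F : σ F ≡ ((+ (2 ^ m) *ℤ + (2 ^ m)) *ℤ + 1024) *ℤ (+ (2 ^ r) *ℤ + (2 ^ m))
  σ-F = begin
      σ F
    ≡⟨ sumℤ-points n (λ α → Δ F α *ℤ Δ F α) ⟩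
      ∑ n (λ α → Δ F α *ℤ Δ F α)
    ≡⟨ ∑-glue (λ α → Δ F α *ℤ Δ F α) ⟩
      ∑ r (λ αu → ∑ m (λ αw → ∑ 4 (λ αv → Δ F (glue αv αu αw) *ℤ Δ F (glue αv αu αw))))
    ≡⟨ ∑-cong r (λ αu → ∑-cong m (λ αw → ∑-cong 4 (λ αv → cong₂ _*ℤ_ (Δ-glue αv αu αw) (Δ-glue αv αu αw)))) ⟩
      ∑ r (λ αu → ∑ m (λ αw → ∑ 4 (λ αv → autocorrelation αv αu αw *ℤ autocorrelation αv αu αw)))
    ≡⟨ ∑-cong r only-αu≡0 ⟩
      ∑ r (λ αu → if isZero (zeros r ⊕ αu) then ∑ m ∑αv² else + 0)
    ≡⟨ ∑-δ r (zeros r) (∑ m ∑αv²) ⟩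
      ∑ m ∑αv²
    ≡⟨ ∑-cong m ∑-autocorrelation₀² ⟩
      ∑ m (λ αw → κ *ℤ (charSum αw *ℤ charSum αw))
    ≡⟨ ∑-*ˡ m κ (λ αw → charSum αw *ℤ charSum αw) ⟩
      κ *ℤ ∑ m (λ αw → charSum αw *ℤ charSum αw)
    ≡⟨ cong (κ *ℤ_) ∑-charSum² ⟩
      κ *ℤ (+ (2 ^ r) *ℤ + (2 ^ m)) ∎
    where
    open ≡-Reasoning
    κ = (+ (2 ^ m) *ℤ + (2 ^ m)) *ℤ + 1024
    ∑αv² : Vec Bool m → ℤ
    ∑αv² αw = ∑ 4 (λ αv → autocorrelation₀ αv αw *ℤ autocorrelation₀ αv αw)
    only-αu≡0 : ∀ αu → ∑ m (λ αw → ∑ 4 (λ αv → autocorrelation αv αu αw *ℤ autocorrelation αv αu αw))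
                     ≡ (if isZero (zeros r ⊕ αu) then ∑ m ∑αv² else + 0)
    only-αu≡0 αu rewrite ⊕-identityˡ αu with isZero αu
    ... | true = refl
    ... | false = trans (∑-cong m (λ αw → ∑-zero 4)) (∑-zero m)

  dot-glue : ∀ bv bu bw v u w → dot (glue bv bu bw) (glue v u w) ≡ dot bv v xor (dot bu u xor dot bw w)
  dot-glue (s' ∷ t' ∷ z₁' ∷ z₂' ∷ []) bu bw (s ∷ t ∷ z₁ ∷ z₂ ∷ []) u w =
    trans (cong (λ x → (s' ∧ s) xor ((t' ∧ t) xor x)) (dot-++ bu (z₁' ∷ z₂' ∷ bw) u (z₁ ∷ z₂ ∷ w)))
      (≡-exhaustive BP._≟_ 6 (λ { (p ∷ q ∷ x ∷ y ∷ U ∷ W ∷ []) → p xor (q xor (U xor (x xor (y xor W)))) })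
                             (λ { (p ∷ q ∷ x ∷ y ∷ U ∷ W ∷ []) → (p xor (q xor (x xor (y xor false)))) xor (U xor W) })
                             ((s' ∧ s) ∷ (t' ∧ t) ∷ (z₁' ∧ z₁) ∷ (z₂' ∧ z₂) ∷ dot bu u ∷ dot bw w ∷ []))

  module _ (bv : Vec Bool 4) (bu : Vec Bool r) (bw : Vec Bool m) (k : Bool) where

    private
      ℓ : Vec Bool n → Bool
      ℓ = affineFun (glue bv bu bw) k
      K : Vec Bool r → Bool
      K u = (c u xor dot bu u) xor k
      Y : Bool → Vec Bool r → ℤ
      Y j u = sgn (K u) *ℤ gadgetW bv j
      p₀ p₁ : Vec Bool r → Vec Bool m
      p₀ u = a u ⊕ bw
      p₁ u = (a u ⊕ e) ⊕ bw
      part : (Vec Bool r → Vec Bool m) → Bool → Vec Bool r → ℤ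
      part p j u = if isZero (p u) then + (2 ^ m) *ℤ Y j u else + 0

    ∑v-sgn-F⊕ℓ : ∀ u w → ∑ 4 (λ v → sgn (F (glue v u w) xor ℓ (glue v u w)))
                        ≡ sgn (dot (p₀ u) w) *ℤ Y false u +ℤ sgn (dot (p₁ u) w) *ℤ Y true u
    ∑v-sgn-F⊕ℓ u w = begin
        ∑ 4 (λ v → sgn (F (glue v u w) xor ℓ (glue v u w)))
      ≡⟨ ∑-cong 4 (λ v → cong₂ (λ x y → sgn (x xor (y xor k))) (F-glue v u w) (dot-glue bv bu bw v u w)) ⟩
        ∑ 4 (λ v → sgn (F′ v u w xor ((dot bv v xor (dot bu u xor dot bw w)) xor k)))
      ≡⟨ ∑-cong 4 (λ v → sgn-gadget-split (usesH v) (q v) (dot bv v) (dot (a u) w) (dot e w) (dot bw w) (c u) (dot bu u) k) ⟩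
        ∑ 4 (λ v → sgn P₀ *ℤ restricted false v +ℤ sgn P₁ *ℤ restricted true v)
      ≡⟨ ∑-distrib-+ 4 (λ v → sgn P₀ *ℤ restricted false v) (λ v → sgn P₁ *ℤ restricted true v) ⟩
        ∑ 4 (λ v → sgn P₀ *ℤ restricted false v) +ℤ ∑ 4 (λ v → sgn P₁ *ℤ restricted true v)
      ≡⟨ cong₂ _+ℤ_ (trans (∑-*ˡ 4 (sgn P₀) (restricted false)) (cong (sgn P₀ *ℤ_) (∑-onUsesH-sgn-xor bv false (K u))))
                    (trans (∑-*ˡ 4 (sgn P₁) (restricted true)) (cong (sgn P₁ *ℤ_) (∑-onUsesH-sgn-xor bv true (K u)))) ⟩
        sgn P₀ *ℤ Y false u +ℤ sgn P₁ *ℤ Y true u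
      ≡⟨ cong₂ (λ x y → sgn x *ℤ Y false u +ℤ sgn y *ℤ Y true u)
               (sym (dot-⊕ˡ (a u) bw w))
               (trans (cong (_xor dot bw w) (sym (dot-⊕ˡ (a u) e w))) (sym (dot-⊕ˡ (a u ⊕ e) bw w))) ⟩
        sgn (dot (p₀ u) w) *ℤ Y false u +ℤ sgn (dot (p₁ u) w) *ℤ Y true u ∎
      where
      open ≡-Reasoning
      P₀ = dot (a u) w xor dot bw w
      P₁ = (dot (a u) w xor dot e w) xor dot bw w
      restricted : Bool → Vec Bool 4 → ℤ
      restricted j v = onUsesH j v (sgn ((q v xor dot bv v) xor K u))

    ∑w-sgn-F⊕ℓ : ∀ u → ∑ m (λ w → sgn (dot (p₀ u) w) *ℤ Y false u +ℤ sgn (dot (p₁ u) w) *ℤ Y true u)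
                      ≡ part p₀ false u +ℤ part p₁ true u
    ∑w-sgn-F⊕ℓ u = begin
        ∑ m (λ w → sgn (dot (p₀ u) w) *ℤ Y false u +ℤ sgn (dot (p₁ u) w) *ℤ Y true u)
      ≡⟨ ∑-distrib-+ m (λ w → sgn (dot (p₀ u) w) *ℤ Y false u) (λ w → sgn (dot (p₁ u) w) *ℤ Y true u) ⟩
        ∑ m (λ w → sgn (dot (p₀ u) w) *ℤ Y false u) +ℤ ∑ m (λ w → sgn (dot (p₁ u) w) *ℤ Y true u)
      ≡⟨ cong₂ _+ℤ_ (∑-*ʳ m (Y false u) (λ w → sgn (dot (p₀ u) w))) (∑-*ʳ m (Y true u) (λ w → sgn (dot (p₁ u) w))) ⟩
        ∑ m (λ w → sgn (dot (p₀ u) w)) *ℤ Y false u +ℤ ∑ m (λ w → sgn (dot (p₁ u) w)) *ℤ Y true u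
      ≡⟨ cong₂ _+ℤ_ (trans (cong (_*ℤ Y false u) (∑-sgn-dot m (p₀ u))) (δ₀-* (p₀ u) (Y false u)))
                    (trans (cong (_*ℤ Y true u) (∑-sgn-dot m (p₁ u))) (δ₀-* (p₁ u) (Y true u))) ⟩
        part p₀ false u +ℤ part p₁ true u ∎
      where open ≡-Reasoning

    ∑-part-≤ : ∀ p j → AtMostOne (λ u → isZero (p u)) → ∑ r (part p j) ≤ℤ + (2 ^ m) *ℤ ∣gadgetW∣ bv j
    ∑-part-≤ p j unique = ∑-atMostOne-≤ r (λ u → isZero (p u)) (λ u → + (2 ^ m) *ℤ Y j u) unique
      (subst (_≤ℤ + (2 ^ m) *ℤ ∣gadgetW∣ bv j) (ℤP.*-zeroʳ (+ (2 ^ m))) (ℤP.*-monoˡ-≤-nonNeg (+ (2 ^ m)) (ℤ.+≤+ z≤n)))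
      (λ u → ℤP.*-monoˡ-≤-nonNeg (+ (2 ^ m)) (sgn*≤∣∣ (K u) (gadgetW bv j)))

    walsh-glue : ∑ n (λ x → sgn (F x xor ℓ x)) ≤ℤ + (2 ^ m) *ℤ + 8
    walsh-glue = begin
        ∑ n (λ x → sgn (F x xor ℓ x))
      ≡⟨ ∑-glue (λ x → sgn (F x xor ℓ x)) ⟩
        ∑ r (λ u → ∑ m (λ w → ∑ 4 (λ v → sgn (F (glue v u w) xor ℓ (glue v u w)))))
      ≡⟨ ∑-cong r (λ u → trans (∑-cong m (∑v-sgn-F⊕ℓ u)) (∑w-sgn-F⊕ℓ u)) ⟩
        ∑ r (λ u → part p₀ false u +ℤ part p₁ true u)
      ≡⟨ ∑-distrib-+ r (part p₀ false) (part p₁ true) ⟩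
        ∑ r (part p₀ false) +ℤ ∑ r (part p₁ true)
      ≤⟨ ℤP.+-mono-≤ (∑-part-≤ p₀ false unique₀) (∑-part-≤ p₁ true unique₁) ⟩
        + (2 ^ m) *ℤ ∣gadgetW∣ bv false +ℤ + (2 ^ m) *ℤ ∣gadgetW∣ bv true
      ≡⟨ ℤP.*-distribˡ-+ (+ (2 ^ m)) (∣gadgetW∣ bv false) (∣gadgetW∣ bv true) ⟨
        + (2 ^ m) *ℤ (∣gadgetW∣ bv false +ℤ ∣gadgetW∣ bv true)
      ≤⟨ ℤP.*-monoˡ-≤-nonNeg (+ (2 ^ m)) (∣gadgetW∣-sum bv) ⟩
        + (2 ^ m) *ℤ + 8 ∎
      where
      open ℤP.≤-Reasoning
      unique₀ : AtMostOne (λ u → isZero (p₀ u))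
      unique₀ x y hx hy = a-injective x y (trans (≡-from-isZero-⊕ _ _ hx) (sym (≡-from-isZero-⊕ _ _ hy)))
      unique₁ : AtMostOne (λ u → isZero (p₁ u))
      unique₁ x y hx hy = a-injective x y (⊕-cancelʳ _ _ e (trans (≡-from-isZero-⊕ _ _ hx) (sym (≡-from-isZero-⊕ _ _ hy))))

  walsh-bound : ∀ b k → ∑ n (λ x → sgn (F x xor affineFun b k x)) ≤ℤ + (2 ^ m) *ℤ + 8
  walsh-bound b k with glue-surjective b
  ... | bv , bu , bw , refl = walsh-glue bv bu bw k

  distance-bound : ∀ b k → 2 ^ (n ∸ 1) ∸ 2 ^ (m + 2) ≤ dist F (affineFun b k)
  distance-bound b k = ℕP.m≤n+o⇒m∸n≤o (2 ^ (n ∸ 1)) (2 ^ (m + 2)) (ℕP.*-cancelˡ-≤ 2 (ℤP.drop‿+≤+ (begin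
      + (2 ^ n)
    ≡⟨ cong +_ (length-tt F∘ℓ) ⟨
      + length (tt F∘ℓ)
    ≡⟨ sumℤ-sgn+2*weight (tt F∘ℓ) ⟨
      sumℤ (map sgn (tt F∘ℓ)) +ℤ + (2 * d)
    ≡⟨ cong (_+ℤ + (2 * d)) (trans (cong sumℤ (sym (LP.map-∘ (points n)))) (sumℤ-points n (λ x → sgn (F∘ℓ x)))) ⟩
      ∑ n (λ x → sgn (F∘ℓ x)) +ℤ + (2 * d)
    ≤⟨ ℤP.+-monoˡ-≤ (+ (2 * d)) (walsh-bound b k) ⟩
      + (2 ^ m) *ℤ + 8 +ℤ + (2 * d)
    ≡⟨ cong₂ _+ℤ_ (sym (ℤP.pos-* (2 ^ m) 8)) refl ⟩
      + (2 ^ m * 8) +ℤ + (2 * d)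
    ≡⟨ ℤP.pos-+ (2 ^ m * 8) (2 * d) ⟨
      + (2 ^ m * 8 + 2 * d)
    ≡⟨ cong +_ (arithmetic (2 ^ m) d) ⟩
      + (2 * (2 ^ m * 4 + d))
    ≡⟨ cong (λ x → + (2 * (x + d))) (ℕP.^-distribˡ-+-* 2 m 2) ⟨
      + (2 * (2 ^ (m + 2) + d)) ∎)))
    where
    open ℤP.≤-Reasoning
    F∘ℓ : BoolFun n
    F∘ℓ x = F x xor affineFun b k x
    d = weight (tt F∘ℓ)
    arithmetic : ∀ x d → x * 8 + 2 * d ≡ 2 * (x * 4 + d)
    arithmetic = NS.solve-∀

  nonlinearity : 2 ^ (n ∸ 1) ∸ 2 ^ (m + 2) ≤ N F
  nonlinearity = N-lower-bound F (ℕP.≤-trans (ℕP.m∸n≤m (2 ^ (n ∸ 1)) (2 ^ (m + 2))) (ℕP.m≤m+n (2 ^ (n ∸ 1)) _)) distance-bound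

binary : ∀ {n} → Vec Bool n → ℕ
binary [] = 0
binary (false ∷ v) = binary v
binary {suc n} (true ∷ v) = 2 ^ n + binary v

binary< : ∀ {n} (v : Vec Bool n) → binary v < 2 ^ n
binary< [] = s≤s z≤n
binary< {suc n} (false ∷ v) = ℕP.<-≤-trans (binary< v) (ℕP.m≤m+n (2 ^ n) (2 ^ n + 0))
binary< {suc n} (true ∷ v) = ℕP.+-monoʳ-< (2 ^ n) (ℕP.<-≤-trans (binary< v) (ℕP.≤-reflexive (sym (ℕP.+-identityʳ _))))

binary-injective : ∀ {n} (u v : Vec Bool n) → binary u ≡ binary v → u ≡ v
binary-injective [] [] _ = refl
binary-injective (false ∷ u) (false ∷ v) e = cong (false ∷_) (binary-injective u v e)
binary-injective {suc n} (true ∷ u) (true ∷ v) e = cong (true ∷_) (binary-injective u v (ℕP.+-cancelˡ-≡ (2 ^ n) _ _ e))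
binary-injective {suc n} (false ∷ u) (true ∷ v) e =
  ⊥-elim (ℕP.<⇒≱ (binary< u) (subst (2 ^ n ≤_) (sym e) (ℕP.m≤m+n (2 ^ n) (binary v))))
binary-injective {suc n} (true ∷ u) (false ∷ v) e =
  ⊥-elim (ℕP.<⇒≱ (binary< v) (subst (2 ^ n ≤_) e (ℕP.m≤m+n (2 ^ n) (binary u))))

toFin : ∀ {n} → Vec Bool n → Fin (2 ^ n)
toFin v = fromℕ< (binary< v)

toFin-injective : ∀ {n} (u v : Vec Bool n) → toFin u ≡ toFin v → u ≡ v
toFin-injective u v e =
  binary-injective u v (trans (sym (FP.toℕ-fromℕ< (binary< u))) (trans (cong toℕ e) (FP.toℕ-fromℕ< (binary< v))))

applyUpTo-+ : ∀ {X : Set} (f : ℕ → X) a b → L.applyUpTo f (a + b) ≡ L.applyUpTo f a ++ₗ L.applyUpTo (λ i → f (a + i)) b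
applyUpTo-+ f zero b = refl
applyUpTo-+ f (suc a) b = cong (f 0 L.∷_) (applyUpTo-+ (λ i → f (suc i)) a b)

tabulate-toℕ : ∀ {X : Set} n (f : ℕ → X) → L.tabulate {n = n} (λ i → f (toℕ i)) ≡ L.applyUpTo f n
tabulate-toℕ zero f = refl
tabulate-toℕ (suc n) f = cong (f 0 L.∷_) (tabulate-toℕ n (λ i → f (suc i)))

map-binary-points : ∀ n → map binary (points n) ≡ L.upTo (2 ^ n)
map-binary-points zero = refl
map-binary-points (suc n) = begin
    map binary (map (false ∷_) P ++ₗ map (true ∷_) P)
  ≡⟨ LP.map-++ binary (map (false ∷_) P) _ ⟩
    map binary (map (false ∷_) P) ++ₗ map binary (map (true ∷_) P)
  ≡⟨ cong₂ _++ₗ_ (sym (LP.map-∘ P)) (trans (sym (LP.map-∘ P)) (LP.map-∘ P)) ⟩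
    map binary P ++ₗ map (_+_ (2 ^ n)) (map binary P)
  ≡⟨ cong (λ l → l ++ₗ map (_+_ (2 ^ n)) l) (map-binary-points n) ⟩
    L.upTo (2 ^ n) ++ₗ map (_+_ (2 ^ n)) (L.upTo (2 ^ n))
  ≡⟨ cong (L.upTo (2 ^ n) ++ₗ_) (LP.map-upTo (_+_ (2 ^ n)) (2 ^ n)) ⟩
    L.upTo (2 ^ n) ++ₗ L.applyUpTo (_+_ (2 ^ n)) (2 ^ n)
  ≡⟨ cong (λ k → L.upTo (2 ^ n) ++ₗ L.applyUpTo (_+_ (2 ^ n)) k) (sym (ℕP.+-identityʳ (2 ^ n))) ⟩
    L.upTo (2 ^ n) ++ₗ L.applyUpTo (_+_ (2 ^ n)) (2 ^ n + 0)
  ≡⟨ applyUpTo-+ (λ i → i) (2 ^ n) (2 ^ n + 0) ⟨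
    L.upTo (2 ^ suc n) ∎
  where
  open ≡-Reasoning
  P = points n

map-toFin-points : ∀ n → map toFin (points n) ≡ L.allFin (2 ^ n)
map-toFin-points n = LP.map-injective FP.toℕ-injective (begin
    map toℕ (map toFin (points n))
  ≡⟨ LP.map-∘ (points n) ⟨
    map (λ v → toℕ (toFin v)) (points n)
  ≡⟨ LP.map-cong (λ v → FP.toℕ-fromℕ< (binary< v)) (points n) ⟩
    map binary (points n)
  ≡⟨ map-binary-points n ⟩
    L.upTo (2 ^ n)
  ≡⟨ tabulate-toℕ (2 ^ n) (λ i → i) ⟨
    L.tabulate toℕ
  ≡⟨ LP.map-tabulate (λ i → i) toℕ ⟨
    map toℕ (L.allFin (2 ^ n)) ∎)
  where open ≡-Reasoning

tt-affineFun-∷ : ∀ {n} (b : Bool) (a : Vec Bool n) c →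
  tt (affineFun (b ∷ a) c) ≡ tt (affineFun a c) ++ₗ tt (affineFun a (c xor b))
tt-affineFun-∷ {n} b a c = begin
    map φ (map (false ∷_) P ++ₗ map (true ∷_) P)
  ≡⟨ LP.map-++ φ (map (false ∷_) P) _ ⟩
    map φ (map (false ∷_) P) ++ₗ map φ (map (true ∷_) P)
  ≡⟨ cong₂ _++ₗ_ (sym (LP.map-∘ P)) (sym (LP.map-∘ P)) ⟩
    map (λ x → φ (false ∷ x)) P ++ₗ map (λ x → φ (true ∷ x)) P
  ≡⟨ cong₂ _++ₗ_ (LP.map-cong (λ x → first-bit-0 b (dot a x) c) P) (LP.map-cong (λ x → first-bit-1 b (dot a x) c) P) ⟩
    tt (affineFun a c) ++ₗ tt (affineFun a (c xor b)) ∎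
  where
  open ≡-Reasoning
  P = points n
  φ = affineFun (b ∷ a) c
  first-bit-0 : ∀ b d c → ((b ∧ false) xor d) xor c ≡ d xor c
  first-bit-0 b d c = cong (λ x → (x xor d) xor c) (BP.∧-zeroʳ b)
  first-bit-1 : ∀ b d c → ((b ∧ true) xor d) xor c ≡ d xor (c xor b)
  first-bit-1 b d c = ≡-exhaustive BP._≟_ 3 (λ { (b ∷ d ∷ c ∷ []) → ((b ∧ true) xor d) xor c })
                                            (λ { (b ∷ d ∷ c ∷ []) → d xor (c xor b) }) (b ∷ d ∷ c ∷ [])

compl-tt-affineFun : ∀ {n} (a : Vec Bool n) c → compl (tt (affineFun a c)) ≡ tt (affineFun a (not c))
compl-tt-affineFun {n} a c = trans (sym (LP.map-∘ (points n))) (LP.map-cong (λ x → BP.not-distribʳ-xor (dot a x) c) (points n))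

take-++ₗ : ∀ {X : Set} (xs ys : List X) k → length xs ≡ k → L.take k (xs ++ₗ ys) ≡ xs
take-++ₗ L.[] ys _ refl = refl
take-++ₗ (x L.∷ xs) ys _ refl = cong (x L.∷_) (take-++ₗ xs ys _ refl)

drop-++ₗ : ∀ {X : Set} (xs ys : List X) k → length xs ≡ k → L.drop k (xs ++ₗ ys) ≡ ys
drop-++ₗ L.[] ys _ refl = refl
drop-++ₗ (x L.∷ xs) ys _ refl = drop-++ₗ xs ys _ refl

==-refl : ∀ (l : List Bool) → (l == l) ≡ true
==-refl l = dec-true (LP.≡-dec BP._≟_ l l) refl

compl-==-self : ∀ (l : List Bool) → length l ≢ 0 → (compl l == l) ≡ false
compl-==-self L.[] l≢0 = ⊥-elim (l≢0 refl)
compl-==-self (x L.∷ l) _ = dec-false (LP.≡-dec BP._≟_ (compl (x L.∷ l)) (x L.∷ l)) (λ eq → BP.not-¬ refl (sym (LP.∷-injectiveˡ eq)))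

onesButLastTwo : (i : ℕ) → Vec Bool (2 + i)
onesButLastTwo zero = false ∷ false ∷ []
onesButLastTwo (suc i) = true ∷ onesButLastTwo i

-- A doubling step of O complements Y exactly when the coefficient of g it reads is 0, since then the
-- second half of X repeats the first; so O flips every coefficient except the last two.
O-affineFun : ∀ i (a : Vec Bool (2 + i)) c rest → Opre i (tt (affineFun a c) ++ₗ rest) ≡ tt (affineFun (a ⊕ onesButLastTwo i) c)
O-affineFun zero (x ∷ y ∷ []) c rest = ≡-exhaustive (LP.≡-dec BP._≟_) 3
  (λ { (x ∷ y ∷ c ∷ []) → Opre zero (tt (affineFun (x ∷ y ∷ []) c)) })
  (λ { (x ∷ y ∷ c ∷ []) → tt (affineFun ((x ∷ y ∷ []) ⊕ onesButLastTwo zero) c) }) (x ∷ y ∷ c ∷ [])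
O-affineFun (suc i) (b ∷ a) c rest = begin
    Opre (suc i) (tt (affineFun (b ∷ a) c) ++ₗ rest)
  ≡⟨ cong (λ l → Opre (suc i) (l ++ₗ rest)) (tt-affineFun-∷ b a c) ⟩
    Opre (suc i) ((T₀ ++ₗ T₁) ++ₗ rest)
  ≡⟨ cong (Opre (suc i)) (LP.++-assoc T₀ T₁ rest) ⟩
    Opre i X ++ₗ (if L.take len (L.drop len X) == L.take len X then compl (Opre i X) else Opre i X)
  ≡⟨ cong₂ (λ y p → y ++ₗ (if p then compl y else y)) (O-affineFun i a c (T₁ ++ₗ rest))
      (cong₂ _==_ (trans (cong (L.take len) (drop-++ₗ T₀ (T₁ ++ₗ rest) len (length-block c))) (take-++ₗ T₁ rest len (length-block (c xor b))))
                  (take-++ₗ T₀ (T₁ ++ₗ rest) len (length-block c))) ⟩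
    Y ++ₗ (if T₁ == T₀ then compl Y else Y)
  ≡⟨ cong (Y ++ₗ_) (second-half b) ⟩
    Y ++ₗ tt (affineFun (a ⊕ onesButLastTwo i) (c xor (b xor true)))
  ≡⟨ tt-affineFun-∷ (b xor true) (a ⊕ onesButLastTwo i) c ⟨
    tt (affineFun ((b ∷ a) ⊕ onesButLastTwo (suc i)) c) ∎
  where
  open ≡-Reasoning
  T₀ = tt (affineFun a c)
  T₁ = tt (affineFun a (c xor b))
  X = T₀ ++ₗ (T₁ ++ₗ rest)
  len = 4 * 2 ^ i
  Y = tt (affineFun (a ⊕ onesButLastTwo i) c)
  length-block : ∀ c → length (tt (affineFun a c)) ≡ len
  length-block c = trans (length-tt (affineFun a c)) (sym (ℕP.*-assoc 2 2 (2 ^ i)))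
  second-half : ∀ b → (if tt (affineFun a (c xor b)) == T₀ then compl Y else Y)
                      ≡ tt (affineFun (a ⊕ onesButLastTwo i) (c xor (b xor true)))
  second-half false rewrite BP.xor-identityʳ c | ==-refl T₀ | BP.xor-comm c true = compl-tt-affineFun (a ⊕ onesButLastTwo i) c
  second-half true rewrite BP.xor-comm c true | BP.xor-identityʳ c | sym (compl-tt-affineFun a c)
                         | compl-==-self T₀ (λ e → ℕP.<⇒≢ (ℕP.m^n>0 2 (2 + i)) (sym (trans (sym (length-tt (affineFun a c))) e))) = refl

lastTwo : ∀ {i} → Vec Bool (2 + i) → Bool × Bool
lastTwo {zero} (x ∷ y ∷ []) = x , y
lastTwo {suc i} (_ ∷ a) = lastTwo a

blockCoefficients : Block → Bool × Bool
blockCoefficients A = true , false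
blockCoefficients B = false , true
blockCoefficients C = true , true
blockCoefficients D = false , false

_==²_ : Bool × Bool → Bool × Bool → Bool
(x , y) ==² (x' , y') = not (x xor x') ∧ not (y xor y')

basedOn-affineFun-++ : ∀ i M (a : Vec Bool (2 + i)) c rest →
  basedOn M (tt (affineFun a c) ++ₗ rest) ≡ (lastTwo a ==² blockCoefficients M) ∧ basedOn M rest
basedOn-affineFun-++ zero M (x ∷ y ∷ []) c rest = cong (_∧ basedOn M rest) (block M (x ∷ y ∷ c ∷ []))
  where
  isBlock coefficientsAre : Block → Vec Bool 3 → Bool
  isBlock M (x ∷ y ∷ c ∷ []) = tt (affineFun (x ∷ y ∷ []) c) == bits M ∨ tt (affineFun (x ∷ y ∷ []) c) == compl (bits M)
  coefficientsAre M (x ∷ y ∷ c ∷ []) = (x , y) ==² blockCoefficients M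
  block : ∀ M v → isBlock M v ≡ coefficientsAre M v
  block A = ≡-exhaustive BP._≟_ 3 (isBlock A) (coefficientsAre A)
  block B = ≡-exhaustive BP._≟_ 3 (isBlock B) (coefficientsAre B)
  block C = ≡-exhaustive BP._≟_ 3 (isBlock C) (coefficientsAre C)
  block D = ≡-exhaustive BP._≟_ 3 (isBlock D) (coefficientsAre D)
basedOn-affineFun-++ (suc i) M (b ∷ a) c rest = begin
    basedOn M (tt (affineFun (b ∷ a) c) ++ₗ rest)
  ≡⟨ cong (λ l → basedOn M (l ++ₗ rest)) (tt-affineFun-∷ b a c) ⟩
    basedOn M ((tt (affineFun a c) ++ₗ tt (affineFun a (c xor b))) ++ₗ rest)
  ≡⟨ cong (basedOn M) (LP.++-assoc (tt (affineFun a c)) _ rest) ⟩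
    basedOn M (tt (affineFun a c) ++ₗ (tt (affineFun a (c xor b)) ++ₗ rest))
  ≡⟨ basedOn-affineFun-++ i M a c _ ⟩
    p ∧ basedOn M (tt (affineFun a (c xor b)) ++ₗ rest)
  ≡⟨ cong (p ∧_) (basedOn-affineFun-++ i M a (c xor b) rest) ⟩
    p ∧ (p ∧ basedOn M rest)
  ≡⟨ BP.∧-assoc p p (basedOn M rest) ⟨
    (p ∧ p) ∧ basedOn M rest
  ≡⟨ cong (_∧ basedOn M rest) (BP.∧-idem p) ⟩
    p ∧ basedOn M rest ∎
  where
  open ≡-Reasoning
  p = lastTwo a ==² blockCoefficients M

basedOn-affineFun : ∀ i M (a : Vec Bool (2 + i)) c → basedOn M (tt (affineFun a c)) ≡ (lastTwo a ==² blockCoefficients M)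
basedOn-affineFun i M a c = begin
    basedOn M (tt (affineFun a c))
  ≡⟨ cong (basedOn M) (LP.++-identityʳ (tt (affineFun a c))) ⟨
    basedOn M (tt (affineFun a c) ++ₗ L.[])
  ≡⟨ basedOn-affineFun-++ i M a c L.[] ⟩
    (lastTwo a ==² blockCoefficients M) ∧ true
  ≡⟨ BP.∧-identityʳ _ ⟩
    lastTwo a ==² blockCoefficients M ∎
  where open ≡-Reasoning

dot-unit⊥onesButLastTwo : ∀ i (α : Vec Bool (2 + i)) → vweight α ≡ 1 → dot (onesButLastTwo i) α ≡ false →
  (∀ a → dot a α ≡ proj₁ (lastTwo a)) ⊎ (∀ a → dot a α ≡ proj₂ (lastTwo a))
dot-unit⊥onesButLastTwo zero (true ∷ false ∷ []) _ _ = inj₁ λ { (x ∷ y ∷ []) → by-table x y }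
  where
  by-table : ∀ x y → (x ∧ true) xor ((y ∧ false) xor false) ≡ x
  by-table x y = ≡-exhaustive BP._≟_ 2 (λ { (x ∷ y ∷ []) → (x ∧ true) xor ((y ∧ false) xor false) }) (λ { (x ∷ y ∷ []) → x }) (x ∷ y ∷ [])
dot-unit⊥onesButLastTwo zero (false ∷ true ∷ []) _ _ = inj₂ λ { (x ∷ y ∷ []) → by-table x y }
  where
  by-table : ∀ x y → (x ∧ false) xor ((y ∧ true) xor false) ≡ y
  by-table x y = ≡-exhaustive BP._≟_ 2 (λ { (x ∷ y ∷ []) → (x ∧ false) xor ((y ∧ true) xor false) }) (λ { (x ∷ y ∷ []) → y }) (x ∷ y ∷ [])
dot-unit⊥onesButLastTwo zero (false ∷ false ∷ []) () _
dot-unit⊥onesButLastTwo zero (true ∷ true ∷ []) () _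
dot-unit⊥onesButLastTwo (suc i) (true ∷ α) unit orth with trans (cong not (sym (dot-zerosʳ (onesButLastTwo i))))
  (subst (λ v → not (dot (onesButLastTwo i) v) ≡ false) (isZero⇒≡zeros α (vweight≡0⇒isZero α (ℕP.suc-injective unit))) orth)
... | ()
dot-unit⊥onesButLastTwo (suc i) (false ∷ α) unit orth with dot-unit⊥onesButLastTwo i α unit orth
... | inj₁ h = inj₁ λ { (x ∷ a) → trans (cong (_xor dot a α) (BP.∧-zeroʳ x)) (h a) }
... | inj₂ h = inj₂ λ { (x ∷ a) → trans (cong (_xor dot a α) (BP.∧-zeroʳ x)) (h a) }

constant-not-balanced : ∀ n b → ¬ Balanced (tt (λ (_ : Vec Bool n) → b))
constant-not-balanced n b balanced = ℕP.<⇒≢ (ℕP.m^n>0 2 n) (sym (2ⁿ≡0 b 2*weight≡2ⁿ))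
  where
  weight-constant : ∀ b (l : List (Vec Bool n)) → weight (map (λ _ → b) l) ≡ (if b then length l else 0)
  weight-constant false L.[] = refl
  weight-constant true L.[] = refl
  weight-constant true (_ L.∷ l) = cong suc (weight-constant true l)
  weight-constant false (_ L.∷ l) = weight-constant false l
  2*weight≡2ⁿ : 2 * (if b then 2 ^ n else 0) ≡ 2 ^ n
  2*weight≡2ⁿ = begin
      2 * (if b then 2 ^ n else 0)
    ≡⟨ cong (λ k → 2 * (if b then k else 0)) (length-points n) ⟨
      2 * (if b then length (points n) else 0)
    ≡⟨ cong (2 *_) (weight-constant b (points n)) ⟨
      2 * weight (tt (λ (_ : Vec Bool n) → b))
    ≡⟨ balanced ⟩
      length (tt (λ (_ : Vec Bool n) → b))
    ≡⟨ length-tt (λ (_ : Vec Bool n) → b) ⟩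
      2 ^ n ∎
    where open ≡-Reasoning
  2ⁿ≡0 : ∀ b → 2 * (if b then 2 ^ n else 0) ≡ 2 ^ n → 2 ^ n ≡ 0
  2ⁿ≡0 false e = sym e
  2ⁿ≡0 true e = trans (sym (ℕP.+-identityʳ (2 ^ n)))
                      (ℕP.+-cancelˡ-≡ (2 ^ n) (2 ^ n + 0) 0 (trans e (sym (ℕP.+-identityʳ (2 ^ n)))))

select : Vec Bool 4 → Bool → Bool → Bool
select v x y = q v xor (if usesH v then y else x)

gadget-select : ∀ v g E → gadget g E v ≡ select v g (g xor E)
gadget-select (s ∷ t ∷ z₁ ∷ z₂ ∷ []) g E = ≡-exhaustive BP._≟_ 6
  (λ { (s ∷ t ∷ z₁ ∷ z₂ ∷ g ∷ E ∷ []) → gadget g E (s ∷ t ∷ z₁ ∷ z₂ ∷ []) })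
  (λ { (s ∷ t ∷ z₁ ∷ z₂ ∷ g ∷ E ∷ []) → select (s ∷ t ∷ z₁ ∷ z₂ ∷ []) g (g xor E) })
  (s ∷ t ∷ z₁ ∷ z₂ ∷ g ∷ E ∷ [])

compl-tt : ∀ {n} (f : BoolFun n) → compl (tt f) ≡ tt (λ x → not (f x))
compl-tt {n} f = sym (LP.map-∘ (points n))

cong₄ : ∀ {A B C D E : Set} (f : A → B → C → D → E) {a a' b b' c c' d d'} →
  a ≡ a' → b ≡ b' → c ≡ c' → d ≡ d' → f a b c d ≡ f a' b' c' d'
cong₄ f refl refl refl refl = refl

quad : List Bool → List Bool → List Bool → List Bool → List Bool
quad x y z w = x ++ₗ (y ++ₗ (z ++ₗ w))

indicator : Bool → ℤ
indicator b = if b then + 1 else + 0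

length-filterᵇ : ∀ {X : Set} (p : X → Bool) (l : List X) → + length (L.filterᵇ p l) ≡ sumℤ (map (λ x → indicator (p x)) l)
length-filterᵇ p L.[] = refl
length-filterᵇ p (x L.∷ l) with p x
... | true = trans (ℤP.pos-+ 1 _) (cong (+ 1 +ℤ_) (length-filterᵇ p l))
... | false = trans (length-filterᵇ p l) (sym (ℤP.+-identityˡ _))

countFin-toFin : ∀ n (p : Fin (2 ^ n) → Bool) → + countFin p ≡ ∑ n (λ u → indicator (p (toFin u)))
countFin-toFin n p = begin
    + length (L.filterᵇ p (L.allFin (2 ^ n)))
  ≡⟨ cong (λ l → + length (L.filterᵇ p l)) (map-toFin-points n) ⟨
    + length (L.filterᵇ p (map toFin (points n)))
  ≡⟨ length-filterᵇ p (map toFin (points n)) ⟩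
    sumℤ (map (λ i → indicator (p i)) (map toFin (points n)))
  ≡⟨ cong sumℤ (LP.map-∘ (points n)) ⟨
    sumℤ (map (λ u → indicator (p (toFin u))) (points n))
  ≡⟨ sumℤ-points n _ ⟩
    ∑ n (λ u → indicator (p (toFin u))) ∎
  where open ≡-Reasoning

Σᴮ : (Block → ℤ) → ℤ
Σᴮ f = f A +ℤ (f B +ℤ (f C +ℤ f D))

Σᴮ-cong : ∀ {f f′ : Block → ℤ} → (∀ M → f M ≡ f′ M) → Σᴮ f ≡ Σᴮ f′
Σᴮ-cong f≗f′ = cong₂ _+ℤ_ (f≗f′ A) (cong₂ _+ℤ_ (f≗f′ B) (cong₂ _+ℤ_ (f≗f′ C) (f≗f′ D)))

Σᴮ-*ˡ : ∀ x (f : Block → ℤ) → Σᴮ (λ M → x *ℤ f M) ≡ x *ℤ Σᴮ f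
Σᴮ-*ˡ x f = distrib x (f A) (f B) (f C) (f D)
  where
  distrib : ∀ x a b c d → x *ℤ a +ℤ (x *ℤ b +ℤ (x *ℤ c +ℤ x *ℤ d)) ≡ x *ℤ (a +ℤ (b +ℤ (c +ℤ d)))
  distrib = solve-∀

decompose : ∀ (φ : Bool × Bool → ℤ) p → φ p ≡ Σᴮ (λ M → indicator (p ==² blockCoefficients M) *ℤ φ (blockCoefficients M))
decompose φ (true , false) = pick (φ (true , false)) (φ (false , true)) (φ (true , true)) (φ (false , false))
  where
  pick : ∀ x y z w → x ≡ + 1 *ℤ x +ℤ (+ 0 *ℤ y +ℤ (+ 0 *ℤ z +ℤ + 0 *ℤ w))
  pick = solve-∀
decompose φ (false , true) = pick (φ (true , false)) (φ (false , true)) (φ (true , true)) (φ (false , false))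
  where
  pick : ∀ x y z w → y ≡ + 0 *ℤ x +ℤ (+ 1 *ℤ y +ℤ (+ 0 *ℤ z +ℤ + 0 *ℤ w))
  pick = solve-∀
decompose φ (true , true) = pick (φ (true , false)) (φ (false , true)) (φ (true , true)) (φ (false , false))
  where
  pick : ∀ x y z w → z ≡ + 0 *ℤ x +ℤ (+ 0 *ℤ y +ℤ (+ 1 *ℤ z +ℤ + 0 *ℤ w))
  pick = solve-∀
decompose φ (false , false) = pick (φ (true , false)) (φ (false , true)) (φ (true , true)) (φ (false , false))
  where
  pick : ∀ x y z w → w ≡ + 0 *ℤ x +ℤ (+ 0 *ℤ y +ℤ (+ 0 *ℤ z +ℤ + 1 *ℤ w))
  pick = solve-∀

∑-Σᴮ : ∀ n (f : Block → Vec Bool n → ℤ) → ∑ n (λ u → Σᴮ (λ M → f M u)) ≡ Σᴮ (λ M → ∑ n (f M))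
∑-Σᴮ n f = begin
    ∑ n (λ u → f A u +ℤ (f B u +ℤ (f C u +ℤ f D u)))
  ≡⟨ ∑-distrib-+ n (f A) _ ⟩
    ∑ n (f A) +ℤ ∑ n (λ u → f B u +ℤ (f C u +ℤ f D u))
  ≡⟨ cong (∑ n (f A) +ℤ_) (∑-distrib-+ n (f B) _) ⟩
    ∑ n (f A) +ℤ (∑ n (f B) +ℤ ∑ n (λ u → f C u +ℤ f D u))
  ≡⟨ cong (λ x → ∑ n (f A) +ℤ (∑ n (f B) +ℤ x)) (∑-distrib-+ n (f C) (f D)) ⟩
    Σᴮ (λ M → ∑ n (f M)) ∎
  where open ≡-Reasoning

∑-equidistributed : ∀ n (p : Vec Bool n → Bool × Bool) (k : ℕ) →
  (∀ M → ∑ n (λ u → indicator (p u ==² blockCoefficients M)) ≡ + k) →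
  ∀ (φ : Bool × Bool → ℤ) → ∑ n (λ u → φ (p u)) ≡ + k *ℤ Σᴮ (λ M → φ (blockCoefficients M))
∑-equidistributed n p k fibres φ = begin
    ∑ n (λ u → φ (p u))
  ≡⟨ ∑-cong n (λ u → decompose φ (p u)) ⟩
    ∑ n (λ u → Σᴮ (λ M → indicator (p u ==² blockCoefficients M) *ℤ φ (blockCoefficients M)))
  ≡⟨ ∑-Σᴮ n (λ M u → indicator (p u ==² blockCoefficients M) *ℤ φ (blockCoefficients M)) ⟩
    Σᴮ (λ M → ∑ n (λ u → indicator (p u ==² blockCoefficients M) *ℤ φ (blockCoefficients M)))
  ≡⟨ Σᴮ-cong (λ M → trans (∑-*ʳ n (φ (blockCoefficients M)) _) (cong (_*ℤ φ (blockCoefficients M)) (fibres M))) ⟩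
    Σᴮ (λ M → + k *ℤ φ (blockCoefficients M))
  ≡⟨ Σᴮ-*ˡ (+ k) (λ M → φ (blockCoefficients M)) ⟩
    + k *ℤ Σᴮ (λ M → φ (blockCoefficients M)) ∎
  where
  open ≡-Reasoning

Conclusion : (ε n : ℕ) → BoolFun n → Set
Conclusion ε n f = Balanced (tt f)
                 × SAC f
                 × (2 ^ (n ∸ 1) ∸ 2 ^ ((n + 1) / 2) ≤ N f)
                 × (+ (2 ^ (2 * n + 2)) ≤ℤ σ f)
                 × (σ f ≤ℤ + (2 ^ (2 * n + 2 + ε)))

Conclusion-resp-≗ : ∀ ε {n} (f f′ : BoolFun n) → (∀ x → f x ≡ f′ x) → Conclusion ε n f′ → Conclusion ε n f
Conclusion-resp-≗ ε {n} f f′ f≗f′ (bal , sac , nl , σ-low , σ-high) =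
  subst Balanced (sym tt≡) bal ,
  (λ c unit → trans (Δ≡ c) (sac c unit)) ,
  subst (2 ^ (n ∸ 1) ∸ 2 ^ ((n + 1) / 2) ≤_) (sym N≡) nl ,
  subst (+ (2 ^ (2 * n + 2)) ≤ℤ_) (sym σ≡) σ-low ,
  subst (_≤ℤ + (2 ^ (2 * n + 2 + ε))) (sym σ≡) σ-high
  where
  tt≡ : tt f ≡ tt f′
  tt≡ = LP.map-cong f≗f′ (points n)
  Δ≡ : ∀ α → Δ f α ≡ Δ f′ α
  Δ≡ α = cong sumℤ (LP.map-cong (λ x → cong₂ (λ y z → sgn y *ℤ sgn z) (f≗f′ x) (f≗f′ (x ⊕ α))) (points n))
  σ≡ : σ f ≡ σ f′
  σ≡ = cong sumℤ (LP.map-cong (λ α → cong₂ _*ℤ_ (Δ≡ α) (Δ≡ α)) (points n))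
  N≡ : N f ≡ N f′
  N≡ = LP.foldr-cong (λ ac k → cong (_⊓ k) (cong weight (LP.map-cong (λ x → cong (_xor affineFun (proj₁ ac) (proj₂ ac) x) (f≗f′ x)) (points n))))
                     refl (affines n)

Conclusion-from-tt : ∀ {ε n n′} → n ≡ n′ → (f : BoolFun n) (f′ : BoolFun n′) → tt f ≡ tt f′ →
  Conclusion ε n′ f′ → Conclusion ε n f
Conclusion-from-tt refl f f′ tt≡ = Conclusion-resp-≗ _ f f′ (tt-injective f f′ tt≡)

module ConstructionInNormalForm (r' ε : ℕ) (g : Fin (2 ^ (2 + r')) → BoolFun (2 + r' + ε))
  (affine : ∀ i → Affine (g i))
  (pairwise-balanced : ∀ i j → i ≢ j → Balanced (tt (λ x → g i x xor g j x))) where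

  r m : ℕ
  r = 2 + r'
  m = r + ε

  a : Vec Bool r → Vec Bool m
  a u = proj₁ (affine (toFin u))

  c : Vec Bool r → Bool
  c u = proj₁ (proj₂ (affine (toFin u)))

  g-affine : ∀ u x → g (toFin u) x ≡ affineFun (a u) (c u) x
  g-affine u = proj₂ (proj₂ (affine (toFin u)))

  e : Vec Bool m
  e = onesButLastTwo (r' + ε)

  a-injective : ∀ u u' → a u ≡ a u' → u ≡ u'
  a-injective u u' a≡ with VP.≡-dec BP._≟_ u u'
  ... | yes u≡u' = u≡u'
  ... | no u≢u' = ⊥-elim (constant-not-balanced m (c u xor c u')
        (subst Balanced sum-is-constant (pairwise-balanced (toFin u) (toFin u') (λ i≡ → u≢u' (toFin-injective u u' i≡)))))
    where
    cancel : ∀ d c c' → (d xor c) xor (d xor c') ≡ c xor c'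
    cancel d c c' = ≡-exhaustive BP._≟_ 3 (λ { (d ∷ c ∷ c' ∷ []) → (d xor c) xor (d xor c') })
                                          (λ { (d ∷ c ∷ c' ∷ []) → c xor c' }) (d ∷ c ∷ c' ∷ [])
    sum-is-constant : tt (λ x → g (toFin u) x xor g (toFin u') x) ≡ tt (λ _ → c u xor c u')
    sum-is-constant = LP.map-cong (λ x → trans (cong₂ _xor_ (g-affine u x) (g-affine u' x))
      (trans (cong (λ b → (dot (a u) x xor c u) xor (dot b x xor c u')) (sym a≡)) (cancel (dot (a u) x) (c u) (c u')))) (points m)

  open NormalForm r m a c e a-injective public
  module Cn = Construction (2 + r) ε g

  gᵤ hᵤ : Vec Bool r → BoolFun m
  gᵤ u = affineFun (a u) (c u)
  hᵤ u = affineFun (a u ⊕ e) (c u)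

  G≡ : ∀ u → Cn.G (toFin u) ≡ tt (gᵤ u)
  G≡ u = LP.map-cong (g-affine u) (points m)

  h≡ : ∀ u → Cn.h (toFin u) ≡ tt (hᵤ u)
  h≡ u = trans (cong (Opre (r' + ε)) (trans (G≡ u) (sym (LP.++-identityʳ _)))) (O-affineFun (r' + ε) (a u) (c u) L.[])

  compl-G≡ : ∀ u → compl (Cn.G (toFin u)) ≡ tt (λ w → not (gᵤ u w))
  compl-G≡ u = trans (cong compl (G≡ u)) (compl-tt (gᵤ u))

  compl-h≡ : ∀ u → compl (Cn.h (toFin u)) ≡ tt (λ w → not (hᵤ u w))
  compl-h≡ u = trans (cong compl (h≡ u)) (compl-tt (hᵤ u))

  F′-select : ∀ v u w → F′ v u w ≡ select v (gᵤ u w) (hᵤ u w)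
  F′-select v u w = trans (gadget-select v (gᵤ u w) (dot e w))
    (cong (select v (gᵤ u w)) (sym (affineFun-⊕ (a u) e (c u) w)))

  row : Bool → Bool → Fin (2 ^ r) → List Bool
  row false false = Cn.P₁
  row false true = Cn.P₂
  row true false = Cn.Q₁
  row true true = Cn.Q₂

  selected : Vec Bool 4 → Vec Bool r → List Bool
  selected v u = map (λ w → select v (gᵤ u w) (hᵤ u w)) (points m)

  selected-row : ∀ s t u → quad (selected (s ∷ t ∷ false ∷ false ∷ []) u) (selected (s ∷ t ∷ false ∷ true ∷ []) u)
                                (selected (s ∷ t ∷ true ∷ false ∷ []) u) (selected (s ∷ t ∷ true ∷ true ∷ []) u)
                           ≡ row s t (toFin u)
  selected-row false false u = sym (cong₄ quad (G≡ u) (h≡ u) (G≡ u) (compl-h≡ u))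
  selected-row false true u = sym (cong₄ quad (h≡ u) (compl-G≡ u) (compl-h≡ u) (compl-G≡ u))
  selected-row true false u = sym (cong₄ quad (compl-h≡ u) (G≡ u) (h≡ u) (G≡ u))
  selected-row true true u = sym (cong₄ quad (compl-G≡ u) (compl-h≡ u) (compl-G≡ u) (h≡ u))

  row-F : ∀ s t u → map (λ z → F (s ∷ t ∷ (u ++ z))) (points (2 + m)) ≡ row s t (toFin u)
  row-F s t u = trans (map-points-2+ m (λ z → F (s ∷ t ∷ (u ++ z))))
    (trans (cong₄ quad (chunk false false) (chunk false true) (chunk true false) (chunk true true)) (selected-row s t u))
    where
    chunk : ∀ z₁ z₂ → map (λ w → F (glue (s ∷ t ∷ z₁ ∷ z₂ ∷ []) u w)) (points m) ≡ selected (s ∷ t ∷ z₁ ∷ z₂ ∷ []) u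
    chunk z₁ z₂ = LP.map-cong (λ w → trans (F-glue v u w) (F′-select v u w)) (points m)
      where v = s ∷ t ∷ z₁ ∷ z₂ ∷ []

  tt-F : tt F ≡ Cn.table
  tt-F = trans (map-points-2+ (r + (2 + m)) F)
    (cong₄ quad (rows false false) (rows false true) (rows true false) (rows true true))
    where
    open ≡-Reasoning
    rows : ∀ s t → map (λ x → F (s ∷ t ∷ x)) (points (r + (2 + m))) ≡ Cn.all (row s t)
    rows s t = begin
        map (λ x → F (s ∷ t ∷ x)) (points (r + (2 + m)))
      ≡⟨ map-points-++ r (2 + m) (λ x → F (s ∷ t ∷ x)) ⟩
        concat (map (λ u → map (λ z → F (s ∷ t ∷ (u ++ z))) (points (2 + m))) (points r))
      ≡⟨ cong concat (LP.map-cong (row-F s t) (points r)) ⟩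
        concat (map (λ u → row s t (toFin u)) (points r))
      ≡⟨ cong concat (LP.map-∘ (points r)) ⟩
        concat (map (row s t) (map toFin (points r)))
      ≡⟨ cong (λ l → concat (map (row s t) l)) (map-toFin-points r) ⟩
        Cn.all (row s t) ∎

  module _ (quarters : ∀ (M : Block) → 4 * countFin (λ i → basedOn M (tt (g i))) ≡ 2 ^ r) where

    count : Block → ℕ
    count M = countFin (λ i → basedOn M (tt (g i)))

    fibre-sizes : ∀ M → ∑ r (λ u → indicator (lastTwo (a u) ==² blockCoefficients M)) ≡ + count A
    fibre-sizes M = begin
        ∑ r (λ u → indicator (lastTwo (a u) ==² blockCoefficients M))
      ≡⟨ ∑-cong r (λ u → cong indicator (basedOn-g u)) ⟨
        ∑ r (λ u → indicator (basedOn M (tt (g (toFin u)))))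
      ≡⟨ countFin-toFin r (λ i → basedOn M (tt (g i))) ⟨
        + count M
      ≡⟨ cong +_ (ℕP.*-cancelˡ-≡ (count M) (count A) 4 (trans (quarters M) (sym (quarters A)))) ⟩
        + count A ∎
      where
      open ≡-Reasoning
      basedOn-g : ∀ u → basedOn M (tt (g (toFin u))) ≡ (lastTwo (a u) ==² blockCoefficients M)
      basedOn-g u = trans (cong (basedOn M) (G≡ u)) (basedOn-affineFun (r' + ε) M (a u) (c u))

    ∑-sgn-coefficient : ∀ (pick : Bool × Bool → Bool) → Σᴮ (λ M → sgn (pick (blockCoefficients M))) ≡ + 0 →
      ∑ r (λ u → sgn (pick (lastTwo (a u)))) ≡ + 0
    ∑-sgn-coefficient pick Σ≡0 = trans (∑-equidistributed r (λ u → lastTwo (a u)) (count A) fibre-sizes (λ p → sgn (pick p)))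
                                       (trans (cong (+ count A *ℤ_) Σ≡0) (ℤP.*-zeroʳ (+ count A)))

    charSum-vanishes : CharSumVanishesOnUnits
    charSum-vanishes αw unit orth with dot-unit⊥onesButLastTwo (r' + ε) αw unit orth
    ... | inj₁ picks₁ = trans (∑-cong r (λ u → cong sgn (picks₁ (a u)))) (∑-sgn-coefficient proj₁ refl)
    ... | inj₂ picks₂ = trans (∑-cong r (λ u → cong sgn (picks₂ (a u)))) (∑-sgn-coefficient proj₂ refl)

  ⌊n+1/2⌋ : ε ≤ 1 → (n + 1) / 2 ≡ m + 2
  ⌊n+1/2⌋ ε≤1 = by-parity ε ε≤1
    where
    by-parity : ∀ ε → ε ≤ 1 → (2 + (r + (2 + (r + ε))) + 1) / 2 ≡ r + ε + 2
    by-parity zero _ = trans (cong (_/ 2) (odd r')) (trans (DM.+-distrib-/-∣ʳ 1 {d = 2} (ND.n∣m*n (r + 0 + 2))) (DM.m*n/n≡m (r + 0 + 2) 2))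
      where
      odd : ∀ r' → 2 + ((2 + r') + (2 + ((2 + r') + 0))) + 1 ≡ 1 + ((2 + r') + 0 + 2) * 2
      odd = NS.solve-∀
    by-parity (suc zero) _ = trans (cong (_/ 2) (even r')) (DM.m*n/n≡m (r + 1 + 2) 2)
      where
      even : ∀ r' → 2 + ((2 + r') + (2 + ((2 + r') + 1))) + 1 ≡ ((2 + r') + 1 + 2) * 2
      even = NS.solve-∀
    by-parity (suc (suc _)) (s≤s ())

  σ-F-exact : σ F ≡ + (2 ^ (2 * n + 2 + ε))
  σ-F-exact = begin
      σ F
    ≡⟨ σ-F ⟩
      ((+ (2 ^ m) *ℤ + (2 ^ m)) *ℤ + 1024) *ℤ (+ (2 ^ r) *ℤ + (2 ^ m))
    ≡⟨ cong₂ (λ x y → (x *ℤ + 1024) *ℤ y) (ℤP.pos-* (2 ^ m) (2 ^ m)) (ℤP.pos-* (2 ^ r) (2 ^ m)) ⟨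
      (+ (2 ^ m * 2 ^ m) *ℤ + 1024) *ℤ + (2 ^ r * 2 ^ m)
    ≡⟨ cong (_*ℤ + (2 ^ r * 2 ^ m)) (ℤP.pos-* (2 ^ m * 2 ^ m) 1024) ⟨
      + (2 ^ m * 2 ^ m * 1024) *ℤ + (2 ^ r * 2 ^ m)
    ≡⟨ ℤP.pos-* (2 ^ m * 2 ^ m * 1024) (2 ^ r * 2 ^ m) ⟨
      + (2 ^ m * 2 ^ m * 1024 * (2 ^ r * 2 ^ m))
    ≡⟨ cong +_ (powers (2 ^ m) (2 ^ r)) ⟩
      + (2 ^ m * 2 ^ m * 2 ^ m * 2 ^ r * 1024)
    ≡⟨ cong +_ (2^-exponent m r) ⟨
      + (2 ^ (m + m + m + r + 10))
    ≡⟨ cong (λ k → + (2 ^ k)) (exponent r' ε) ⟨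
      + (2 ^ (2 * n + 2 + ε)) ∎
    where
    open ≡-Reasoning
    exponent : ∀ r' ε → 2 * (2 + ((2 + r') + (2 + ((2 + r') + ε)))) + 2 + ε
                      ≡ (2 + r') + ε + ((2 + r') + ε) + ((2 + r') + ε) + (2 + r') + 10
    exponent = NS.solve-∀
    2^-exponent : ∀ m r → 2 ^ (m + m + m + r + 10) ≡ 2 ^ m * 2 ^ m * 2 ^ m * 2 ^ r * 1024
    2^-exponent m r = begin
        2 ^ (m + m + m + r + 10)
      ≡⟨ ℕP.^-distribˡ-+-* 2 (m + m + m + r) 10 ⟩
        2 ^ (m + m + m + r) * 1024
      ≡⟨ cong (_* 1024) (ℕP.^-distribˡ-+-* 2 (m + m + m) r) ⟩
        2 ^ (m + m + m) * 2 ^ r * 1024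
      ≡⟨ cong (λ x → x * 2 ^ r * 1024) (ℕP.^-distribˡ-+-* 2 (m + m) m) ⟩
        2 ^ (m + m) * 2 ^ m * 2 ^ r * 1024
      ≡⟨ cong (λ x → x * 2 ^ m * 2 ^ r * 1024) (ℕP.^-distribˡ-+-* 2 m m) ⟩
        2 ^ m * 2 ^ m * 2 ^ m * 2 ^ r * 1024 ∎
    powers : ∀ x y → x * x * 1024 * (y * x) ≡ x * x * x * y * 1024
    powers = NS.solve-∀

  F-conclusion : ε ≤ 1 → (∀ (M : Block) → 4 * countFin (λ i → basedOn M (tt (g i))) ≡ 2 ^ r) → Conclusion ε n F
  F-conclusion ε≤1 quarters =
    balanced ,
    sac (charSum-vanishes quarters) ,
    subst (λ k → 2 ^ (n ∸ 1) ∸ 2 ^ k ≤ N F) (sym (⌊n+1/2⌋ ε≤1)) nonlinearity ,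
    subst (+ (2 ^ (2 * n + 2)) ≤ℤ_) (sym σ-F-exact) (ℤ.+≤+ (ℕP.^-monoʳ-≤ 2 (ℕP.m≤m+n (2 * n + 2) ε))) ,
    ℤP.≤-reflexive σ-F-exact

theorem2 : (k ε : ℕ) → ε ≤ 1 → 4 ≤ k →
    (g : Fin (2 ^ (k ∸ 2)) → BoolFun (k ∸ 2 + ε)) →
    (∀ i → Affine (g i)) →
    (∀ (M : Block) → 4 * countFin (λ i → basedOn M (tt (g i))) ≡ 2 ^ (k ∸ 2)) →
    (∀ i j → i ≢ j → Balanced (tt (λ x → g i x xor g j x))) →
    (f : BoolFun (2 * k + ε)) →
    tt f ≡ Construction.table k ε g →
    Balanced (tt f)
      × SAC f
      × (2 ^ (2 * k + ε ∸ 1) ∸ 2 ^ ((2 * k + ε + 1) / 2) ≤ N f)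
      × (+ (2 ^ (2 * (2 * k + ε) + 2)) ≤ℤ σ f)
      × (σ f ≤ℤ + (2 ^ (2 * (2 * k + ε) + 2 + ε)))
theorem2 1 _ _ (s≤s ()) _ _ _ _ _ _
theorem2 2 _ _ (s≤s (s≤s ())) _ _ _ _ _ _
theorem2 3 _ _ (s≤s (s≤s (s≤s ()))) _ _ _ _ _ _
theorem2 (suc (suc (suc (suc r')))) ε ε≤1 _ g affine quarters pairwise-balanced f tt-f≡table =
  Conclusion-from-tt (dimension r' ε) f F (trans tt-f≡table (sym tt-F)) (F-conclusion ε≤1 quarters)
  where
  open ConstructionInNormalForm r' ε g affine pairwise-balanced
  dimension : ∀ r' ε → 2 * (4 + r') + ε ≡ 2 + ((2 + r') + (2 + ((2 + r') + ε)))
  dimension = NS.solve-∀
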